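{- Let $h\ge 3$ and let $M_h$ be the Möbius ladder with $h$ rungs. Then $pn(\mathcal{E}_{c}(M_{h}))=3$.
   Context: The Möbius ladder $M_h$ ($h\ge 3$) is the graph obtained from the cycle $v_1v_2\cdots v_{2h}v_1$ by adding the $h$ chords $v_iv_{i+h}$ for $1\le i\le h$; in particular $M_3=K_{3,3}$. A book embedding of a graph consists of a linear order of its vertices (along the spine) together with an assignment of each edge to one of finitely many pages, such that no two edges assigned to the same page cross, where edges $ab$ and $cd$ cross iff their endpoints alternate in the linear order. The pagenumber $pn(G)$ is the minimum number of pages over all book embeddings of $G$. For a graph $G$, the complete expansion graph $\mathcal{E}_{c}(G)$ is the graph with vertex set $\{(v,e) : v\in V(G),\ e\in E(G),\ v \text{ is incident with } e\}$ and edge set $E_1\cup E_2$, where $E_1=\{(v,e)(v,f) : v\in V(G),\ e\neq f \in E(G) \text{ both incident with } v\}$ and $E_2=\{(v,e)(w,e) : e=vw\in E(G)\}$ (each vertex $v$ is replaced by a complete graph $K_{d_G(v)}$, and each edge $vw$ of $G$ becomes one edge joining these complete graphs). -}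

module Defs where

open import Data.Nat using (ℕ; _+_; _<_; _∸_; _≡ᵇ_)
open import Data.Fin using (Fin; toℕ)
open import Data.Bool using (Bool; true; false; _∧_; _∨_; not; T)
open import Data.Product using (Σ; _×_; _,_; Σ-syntax)
open import Relation.Nullary using (¬_; does)
open import Relation.Binary.Definitions using (DecidableEquality)
open import Relation.Binary.PropositionalEquality using (_≡_)
open import Function.Definitions using (Injective)

record Graph : Set₁ where
  field
    V   : Set
    _≟_ : DecidableEquality V
    adj : V → V → Bool
open Graph public

-- A book embedding of G with k pages:
--  * a linear order of the vertices, given by an injective position map
--    pos : V → ℕ  (u before v iff pos u < pos v);
--  * a page for each edge (an edge uv is given by either orientation,
--    and both orientations must get the same page);
--  * no two edges on the same page cross, i.e. have alternating endpoints
--    a < c < b < d (all orientations/orders of the two edges are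
--    quantified over, so this covers every alternation pattern).
BookEmbedding : Graph → ℕ → Set
BookEmbedding G k =
  Σ[ pos ∈ (V G → ℕ) ] Injective _≡_ _≡_ pos ×
  Σ[ page ∈ ((u v : V G) → T (adj G u v) → Fin k) ]
    ((∀ u v (p : T (adj G u v)) (q : T (adj G v u)) → page u v p ≡ page v u q) ×
     (∀ a b c d (p : T (adj G a b)) (q : T (adj G c d)) →
        page a b p ≡ page c d q →
        ¬ (pos a < pos c × pos c < pos b × pos b < pos d)))

PagenumberIs : Graph → ℕ → Set
PagenumberIs G k = BookEmbedding G k × (∀ j → j < k → ¬ BookEmbedding G j)

-- Möbius ladder M_h: vertices 0,…,2h-1 (vertex i stands for v_{i+1}),
-- cycle edges i ~ i+1 (and 2h-1 ~ 0), chords i ~ i+h.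
mobius : ℕ → Graph
mobius h = record
  { V = Fin (h + h)
  ; _≟_ = Data.Fin._≟_
  ; adj = λ i j →
      let a = toℕ i ; b = toℕ j ; top = (h + h) ∸ 1 in
      (b ≡ᵇ a + 1) ∨ (a ≡ᵇ b + 1) ∨
      ((a ≡ᵇ 0) ∧ (b ≡ᵇ top)) ∨ ((b ≡ᵇ 0) ∧ (a ≡ᵇ top)) ∨
      (b ≡ᵇ a + h) ∨ (a ≡ᵇ b + h)
  }
  where import Data.Fin

-- A vertex (v, e) with e incident to v
-- is represented as (v, w, _) where e = vw (w the other end of e).
--  E1: (v,e)(v,f) with e ≠ f, i.e. same v and different other ends;
--  E2: (v,e)(w,e) with e = vw.
completeExpansion : Graph → Graph
completeExpansion G = record
  { V = Σ[ v ∈ V G ] Σ[ w ∈ V G ] T (adj G v w)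
  ; _≟_ = decEq
  ; adj = λ { (v , w , _) (v' , w' , _) →
      (eq v v' ∧ not (eq w w')) ∨ (eq v w' ∧ eq w v') }
  }
  where
  eq : V G → V G → Bool
  eq x y = does (_≟_ G x y)
  open import Relation.Binary.PropositionalEquality using (refl; cong)
  open import Relation.Nullary using (yes; no)
  open import Data.Unit using (tt)
  decEq : DecidableEquality (Σ[ v ∈ V G ] Σ[ w ∈ V G ] T (adj G v w))
  decEq (v , w , p) (v' , w' , p') with _≟_ G v v' | _≟_ G w w'
  ... | no ne | _ = no λ { refl → ne refl }
  ... | yes refl | no ne = no λ { refl → ne refl }
  ... | yes refl | yes refl = yes (cong (λ r → v , w , r) (T-irr (adj G v w) p p'))
    where
    T-irr : (b : Bool) (x y : T b) → x ≡ y
    T-irr true tt tt = refl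

module Submission where

open import Defs
open import Data.Nat using (ℕ; _≤_; _<_; suc; s≤s; z≤n)
open import Data.Bool using (Bool)
open import Data.Product using (_×_; _,_)
open import Data.Fin using (inject₁)
open import Data.Fin.Properties using (inject₁-injective)
open import Relation.Nullary using (¬_)
open import Relation.Binary.PropositionalEquality using (_≡_; cong)

-- The triangle replacing the ladder
-- vertex a takes three consecutive spine positions; the triangles of
-- 0, 1, …, h - 1 come first, then those of 2h - 1, …, h.  Every edge then
-- has one of five shapes: consecutive positions, the outer edge of a
-- triangle, the two ladder edges 0 ~ 2h - 1 and h - 1 ~ h, and the chords,
-- which sit symmetrically about the middle of the spine and so nest.  The
-- page of an edge is read off its shape, and shapes on one page never cross.
--
-- A two-page book embedding is a planar drawing, and the
-- Jordan curve argument is run combinatorially (TwoPageDrawing): count, mod 2,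
-- the edges of a walk passing above a spine point on the top page.  This
-- parity is invariant along edges avoiding a closed curve, and in a theta
-- graph an odd number of first steps lie inside the cycle formed by the
-- other two paths.  In the expansion, the copies along the cycle of M_h form
-- a rim, and the copies X a, X b of two interleaving chords lie on opposite
-- sides of it (NoTwoPageEmbedding); the chords at 0, 1, 2 interleave
-- pairwise, which two sides cannot accommodate.  Fewer pages reduce to two
-- by adding empty pages.

module Spine where

  open import Data.Nat
  open import Data.Nat.Properties
  open import Data.Bool using (Bool; true; false; _xor_; not; T)
  open import Data.Bool.Properties using (xor-comm)
  open import Data.Empty using (⊥-elim)
  open import Relation.Nullary using (¬_)
  open import Relation.Binary.PropositionalEquality
  open import Relation.Binary.Definitions using (tri<; tri≈; tri>)

  T⇒≡true : ∀ {b} → T b → b ≡ true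
  T⇒≡true {true} _ = refl

  ¬T⇒≡false : ∀ {b} → ¬ T b → b ≡ false
  ¬T⇒≡false {true}  ¬t = ⊥-elim (¬t _)
  ¬T⇒≡false {false} _  = refl

  <ᵇ-true : ∀ {m n} → m < n → (m <ᵇ n) ≡ true
  <ᵇ-true m<n = T⇒≡true (<⇒<ᵇ m<n)

  <ᵇ-false : ∀ {m n} → n ≤ m → (m <ᵇ n) ≡ false
  <ᵇ-false {m} {n} n≤m = ¬T⇒≡false (λ t → <⇒≱ (<ᵇ⇒< m n t) n≤m)

  -- spans x y n: exactly one of the spine positions x, y lies left of n; for n
  -- different from x and y this says that n lies strictly between x and y.
  spans : ℕ → ℕ → ℕ → Bool
  spans x y n = (x <ᵇ n) xor (y <ᵇ n)

  spans-sym : ∀ x y n → spans x y n ≡ spans y x n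
  spans-sym x y n = xor-comm (x <ᵇ n) (y <ᵇ n)

  <ᵇ-flip : ∀ {x y} → x ≢ y → (y <ᵇ x) ≡ not (x <ᵇ y)
  <ᵇ-flip {x} {y} x≢y with <-cmp x y
  ... | tri< x<y _ _ rewrite <ᵇ-true x<y | <ᵇ-false (<⇒≤ x<y) = refl
  ... | tri≈ _ x≡y _ = ⊥-elim (x≢y x≡y)
  ... | tri> _ _ y<x rewrite <ᵇ-true y<x | <ᵇ-false (<⇒≤ y<x) = refl

  data Side (a n : ℕ) : Set where
    left  : a < n → Side a n
    right : n < a → Side a n

  side : ∀ a n → a ≢ n → Side a n
  side a n a≢n with <-cmp a n
  ... | tri< a<n _ _ = left a<n
  ... | tri≈ _ a≡n _ = ⊥-elim (a≢n a≡n)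
  ... | tri> _ _ n<a = right n<a

  is-left : ∀ {a n} → Side a n → Bool
  is-left (left _)  = true
  is-left (right _) = false

  <ᵇ-side : ∀ {a n} (s : Side a n) → (a <ᵇ n) ≡ is-left s
  <ᵇ-side (left a<n)  = <ᵇ-true a<n
  <ᵇ-side (right n<a) = <ᵇ-false (<⇒≤ n<a)

  -- The eight ways in which a chord {A,B} and a chord {X,Y} (four distinct
  -- positions) can interleave, named by the left-to-right order of the ends.
  data Interleaved (A B X Y : ℕ) : Set where
    AXBY : A < X → X < B → B < Y → Interleaved A B X Y
    YAXB : Y < A → A < X → X < B → Interleaved A B X Y
    BXAY : B < X → X < A → A < Y → Interleaved A B X Y
    YBXA : Y < B → B < X → X < A → Interleaved A B X Y
    AYBX : A < Y → Y < B → B < X → Interleaved A B X Y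
    XAYB : X < A → A < Y → Y < B → Interleaved A B X Y
    BYAX : B < Y → Y < A → A < X → Interleaved A B X Y
    XBYA : X < B → B < Y → Y < A → Interleaved A B X Y

  separated⇒interleaved : ∀ {A B X Y} → A ≢ X → B ≢ X → A ≢ Y → B ≢ Y →
                           spans A B X ≢ spans A B Y → Interleaved A B X Y
  separated⇒interleaved {A} {B} {X} {Y} A≢X B≢X A≢Y B≢Y separated =
    by-sides (side A X A≢X) (side B X B≢X) (side A Y A≢Y) (side B Y B≢Y)
      (λ same → separated
         (trans (cong₂ _xor_ (<ᵇ-side (side A X A≢X)) (<ᵇ-side (side B X B≢X)))
         (trans same (sym (cong₂ _xor_ (<ᵇ-side (side A Y A≢Y)) (<ᵇ-side (side B Y B≢Y)))))))
    where
    -- The chord {A,B} separates X from Y exactly when X and Y have different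
    -- numbers of endpoints to their left.
    by-sides : (sAX : Side A X) (sBX : Side B X) (sAY : Side A Y) (sBY : Side B Y) →
               (is-left sAX xor is-left sBX) ≢ (is-left sAY xor is-left sBY) → Interleaved A B X Y
    by-sides (left ax)  (right xb) (left ay)  (left by)  _ = AXBY ax xb by
    by-sides (left ax)  (right xb) (right ya) (right yb) _ = YAXB ya ax xb
    by-sides (right xa) (left bx)  (left ay)  (left by)  _ = BXAY bx xa ay
    by-sides (right xa) (left bx)  (right ya) (right yb) _ = YBXA yb bx xa
    by-sides (left ax)  (left bx)  (left ay)  (right yb) _ = AYBX ay yb bx
    by-sides (right xa) (right xb) (left ay)  (right yb) _ = XAYB xa ay yb
    by-sides (left ax)  (left bx)  (right ya) (left by)  _ = BYAX by ya ax
    by-sides (right xa) (right xb) (right ya) (left by)  _ = XBYA xb by ya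
    by-sides (left _)  (right _) (left _)  (right _) ne = ⊥-elim (ne refl)
    by-sides (left _)  (right _) (right _) (left _)  ne = ⊥-elim (ne refl)
    by-sides (right _) (left _)  (left _)  (right _) ne = ⊥-elim (ne refl)
    by-sides (right _) (left _)  (right _) (left _)  ne = ⊥-elim (ne refl)
    by-sides (left _)  (left _)  (left _)  (left _)  ne = ⊥-elim (ne refl)
    by-sides (left _)  (left _)  (right _) (right _) ne = ⊥-elim (ne refl)
    by-sides (right _) (right _) (left _)  (left _)  ne = ⊥-elim (ne refl)
    by-sides (right _) (right _) (right _) (right _) ne = ⊥-elim (ne refl)

-- Walks are non-empty lists x ∷ W of vertices.
module Walks where

  open import Data.List using (List; []; _∷_; _++_)
  open import Relation.Binary.PropositionalEquality using (_≡_; refl)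

  end : ∀ {A : Set} → A → List A → A
  end x []      = x
  end x (y ∷ W) = end y W

  end-++ : ∀ {A : Set} (x : A) xs y ys → end x (xs ++ y ∷ ys) ≡ end y ys
  end-++ x []        y ys = refl
  end-++ x (x' ∷ xs) y ys = end-++ x' xs y ys

-- The results are discrete versions of
-- the Jordan curve theorem and of the theta-graph lemma for such drawings.
module TwoPageDrawing
  (V : Set) (pos : V → ℕ) (E : V → V → Set) (E-sym : ∀ {a b} → E a b → E b a)
  (page : V → V → Bool) (page-sym : ∀ a b → page a b ≡ page b a)
  (no-crossing : ∀ a b c d → E a b → E c d → page a b ≡ page c d →
                 ¬ (pos a < pos c × pos c < pos b × pos b < pos d))
  where

  open import Data.Nat
  open import Data.Bool using (Bool; true; false; _∧_; _xor_; not; if_then_else_)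
  open import Data.Product using (_×_; _,_)
  open import Relation.Nullary using (¬_)
  open import Relation.Binary.PropositionalEquality
  open import Data.Bool.Solver using (module xor-∧-Solver)
  open import Data.Bool.Properties using (xor-same; xor-identityʳ) renaming (_≟_ to _≟ᵇ_)
  open import Data.Empty using (⊥-elim)
  open import Data.List using (List; []; _∷_)
  open import Data.List.Relation.Unary.All using (All; []; _∷_; head)
  open import Data.List.Relation.Unary.Linked using (Linked; []; [-]; _∷_)
  open import Relation.Nullary using (yes; no)
  open Spine
  open Walks

  open xor-∧-Solver using (solve; _:+_; _:*_; _:=_; con)

  no-interleaving : ∀ a b x y → E a b → E x y → page a b ≡ page x y →
                    ¬ Interleaved (pos a) (pos b) (pos x) (pos y)
  no-interleaving a b x y ab xy same (AXBY p q r) =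
    no-crossing a b x y ab xy same (p , q , r)
  no-interleaving a b x y ab xy same (YAXB p q r) =
    no-crossing y x a b (E-sym xy) ab (trans (page-sym y x) (sym same)) (p , q , r)
  no-interleaving a b x y ab xy same (BXAY p q r) =
    no-crossing b a x y (E-sym ab) xy (trans (page-sym b a) same) (p , q , r)
  no-interleaving a b x y ab xy same (YBXA p q r) =
    no-crossing y x b a (E-sym xy) (E-sym ab) (trans (page-sym y x) (trans (sym same) (page-sym a b))) (p , q , r)
  no-interleaving a b x y ab xy same (AYBX p q r) =
    no-crossing a b y x ab (E-sym xy) (trans same (page-sym x y)) (p , q , r)
  no-interleaving a b x y ab xy same (XAYB p q r) =
    no-crossing x y a b xy ab (sym same) (p , q , r)
  no-interleaving a b x y ab xy same (BYAX p q r) =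
    no-crossing b a y x (E-sym ab) (E-sym xy) (trans (page-sym b a) (trans same (page-sym x y))) (p , q , r)
  no-interleaving a b x y ab xy same (XBYA p q r) =
    no-crossing x y b a xy (E-sym ab) (trans (sym same) (page-sym a b)) (p , q , r)

  on-page : Bool → Bool → Bool
  on-page q p = if q then p else not p

  on-page-unique : ∀ q p p' → on-page q p ≡ true → on-page q p' ≡ true → p ≡ p'
  on-page-unique true  true  true  _ _ = refl
  on-page-unique false false false _ _ = refl

  covers : Bool → V → V → ℕ → Bool
  covers q x y n = on-page q (page x y) ∧ spans (pos x) (pos y) n

  covers-sym : ∀ q x y n → covers q x y n ≡ covers q y x n
  covers-sym q x y n = cong₂ (λ p s → on-page q p ∧ s) (page-sym x y) (spans-sym (pos x) (pos y) n)

  -- crossings q W n: parity of the number of edges of the walk W on page q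
  -- passing over the spine point n (a discrete ray-crossing count).
  crossings : Bool → List V → ℕ → Bool
  crossings q []          n = false
  crossings q (x ∷ [])    n = false
  crossings q (x ∷ y ∷ W) n = covers q x y n xor crossings q (y ∷ W) n

  Walk : List V → Set
  Walk = Linked E

  Avoids : ℕ → List V → Set
  Avoids n W = All (λ z → pos z ≢ n) W

  crossings-both-pages : ∀ x W n →
    crossings true (x ∷ W) n xor crossings false (x ∷ W) n ≡ spans (pos x) (pos (end x W)) n
  crossings-both-pages x []      n = sym (xor-same (pos x <ᵇ n))
  crossings-both-pages x (y ∷ W) n = begin
    ((page x y ∧ s) xor top) xor ((not (page x y) ∧ s) xor bottom)
      ≡⟨ split-pages (page x y) s top bottom ⟩
    s xor (top xor bottom)
      ≡⟨ cong (s xor_) (crossings-both-pages y W n) ⟩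
    s xor spans (pos y) (pos (end y W)) n
      ≡⟨ telescope (pos x <ᵇ n) (pos y <ᵇ n) (pos (end y W) <ᵇ n) ⟩
    spans (pos x) (pos (end y W)) n ∎
    where
    open ≡-Reasoning
    s top bottom : Bool
    s      = spans (pos x) (pos y) n
    top    = crossings true (y ∷ W) n
    bottom = crossings false (y ∷ W) n
    split-pages : ∀ p s c d → ((p ∧ s) xor c) xor ((not p ∧ s) xor d) ≡ s xor (c xor d)
    split-pages = solve 4 (λ p s c d →
      ((p :* s) :+ c) :+ (((con true :+ p) :* s) :+ d) := s :+ (c :+ d)) refl
    telescope : ∀ a b c → (a xor b) xor (b xor c) ≡ a xor c
    telescope = solve 3 (λ a b c → (a :+ b) :+ (b :+ c) := a :+ c) refl

  -- Crossing an edge xy of page q (with x, y off the walk W) does not change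
  -- the page-q crossing parity of W: an edge of W on page q interleaving with
  -- xy would cross it.
  crossings-across-edge : ∀ q x y → E x y → on-page q (page x y) ≡ true →
    ∀ W → Walk W → Avoids (pos x) W → Avoids (pos y) W →
    crossings q W (pos x) ≡ crossings q W (pos y)
  crossings-across-edge q x y xy on-q []          _ _ _ = refl
  crossings-across-edge q x y xy on-q (a ∷ [])    _ _ _ = refl
  crossings-across-edge q x y xy on-q (a ∷ b ∷ W) (ab ∷ walk) (a≢x ∷ x-rest) (a≢y ∷ y-rest) =
    cong₂ _xor_ first-edge (crossings-across-edge q x y xy on-q (b ∷ W) walk x-rest y-rest)
    where
    b≢x : pos b ≢ pos x
    b≢x = head x-rest
    b≢y : pos b ≢ pos y
    b≢y = head y-rest
    first-edge : covers q a b (pos x) ≡ covers q a b (pos y)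
    first-edge with on-page q (page a b) in ab-on-q
    ... | false = refl
    ... | true with spans (pos a) (pos b) (pos x) ≟ᵇ spans (pos a) (pos b) (pos y)
    ...   | yes same = same
    ...   | no separated = ⊥-elim (no-interleaving a b x y ab xy
              (on-page-unique q (page a b) (page x y) ab-on-q on-q)
              (separated⇒interleaved a≢x b≢x a≢y b≢y separated))

  xor-shift : ∀ {a a' b s s'} → a xor b ≡ s → a' xor b ≡ s' → a' ≡ a xor (s xor s')
  xor-shift {a} {a'} {b} refl refl = shift a a' b
    where
    shift : ∀ a a' b → a' ≡ a xor ((a xor b) xor (a' xor b))
    shift = solve 3 (λ a a' b → a' := a :+ ((a :+ b) :+ (a' :+ b))) refl

  top-crossings-across-edge : ∀ u w → E u w → ∀ x W → Walk (x ∷ W) →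
    Avoids (pos u) (x ∷ W) → Avoids (pos w) (x ∷ W) →
    crossings true (x ∷ W) (pos w) ≡
      crossings true (x ∷ W) (pos u) xor
      (not (page u w) ∧ (spans (pos x) (pos (end x W)) (pos u) xor spans (pos x) (pos (end x W)) (pos w)))
  top-crossings-across-edge u w uw x W walk u-off w-off with page u w in uw-page
  ... | true  = trans (sym (crossings-across-edge true u w uw uw-page (x ∷ W) walk u-off w-off))
                      (sym (xor-identityʳ _))
  ... | false = xor-shift {a = crossings true (x ∷ W) (pos u)}
    (crossings-both-pages x W (pos u))
    (trans (cong (crossings true (x ∷ W) (pos w) xor_)
                 (crossings-across-edge false u w uw (cong not uw-page) (x ∷ W) walk u-off w-off))
           (crossings-both-pages x W (pos w)))

  -- For two walks with common ends (a closed curve), inside W W' n is the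
  -- parity of crossings of the curve by the top-page ray at n.
  inside : List V → List V → ℕ → Bool
  inside W W' n = crossings true W n xor crossings true W' n

  -- Discrete Jordan curve theorem: the parity does not change along an edge
  -- that avoids the curve, since the ends of both walks agree.
  inside-across-edge : ∀ x W W' → end x W ≡ end x W' → Walk (x ∷ W) → Walk (x ∷ W') →
    ∀ a b → E a b → Avoids (pos a) (x ∷ W) → Avoids (pos b) (x ∷ W) →
    Avoids (pos a) (x ∷ W') → Avoids (pos b) (x ∷ W') →
    inside (x ∷ W) (x ∷ W') (pos a) ≡ inside (x ∷ W) (x ∷ W') (pos b)
  inside-across-edge x W W' same-end walk walk' a b ab a-off b-off a-off' b-off' = begin
    crossings true (x ∷ W) (pos a) xor crossings true (x ∷ W') (pos a)
      ≡⟨ sym (cancel (crossings true (x ∷ W) (pos a)) (crossings true (x ∷ W') (pos a)) (jump (end x W))) ⟩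
    (crossings true (x ∷ W) (pos a) xor jump (end x W)) xor
    (crossings true (x ∷ W') (pos a) xor jump (end x W))
      ≡⟨ cong₂ _xor_ (sym (top-crossings-across-edge a b ab x W walk a-off b-off))
                     (trans (cong (λ z → crossings true (x ∷ W') (pos a) xor jump z) same-end)
                            (sym (top-crossings-across-edge a b ab x W' walk' a-off' b-off'))) ⟩
    crossings true (x ∷ W) (pos b) xor crossings true (x ∷ W') (pos b) ∎
    where
    open ≡-Reasoning
    jump : V → Bool
    jump v = not (page a b) ∧ (spans (pos x) (pos v) (pos a) xor spans (pos x) (pos v) (pos b))
    cancel : ∀ c d j → (c xor j) xor (d xor j) ≡ c xor d
    cancel = solve 3 (λ c d j → (c :+ j) :+ (d :+ j) := c :+ d) refl

  inside-along-walk : ∀ x W W' → end x W ≡ end x W' → Walk (x ∷ W) → Walk (x ∷ W') →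
    ∀ z zs → Walk (z ∷ zs) →
    All (λ w → Avoids (pos w) (x ∷ W) × Avoids (pos w) (x ∷ W')) (z ∷ zs) →
    inside (x ∷ W) (x ∷ W') (pos z) ≡ inside (x ∷ W) (x ∷ W') (pos (end z zs))
  inside-along-walk x W W' same-end walk walk' z [] _ _ = refl
  inside-along-walk x W W' same-end walk walk' z (z' ∷ zs) (zz' ∷ path)
                    ((z-off , z-off') ∷ rest@((z'-off , z'-off') ∷ _)) =
    trans (inside-across-edge x W W' same-end walk walk' z z' zz' z-off z'-off z-off' z'-off')
          (inside-along-walk x W W' same-end walk walk' z' zs path rest)

  -- The top-page parity of a walk u ∷ n ∷ … ∷ v at a further neighbour w of u,
  -- computed from data local to u: the page p of un, the page p' of uw, the
  -- parity m of the tail n ∷ … ∷ v at u, and the relative order of u, n, v, w.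
  local-parity : (p p' m uw nw nu vu vw : Bool) → Bool
  local-parity p p' m uw nw nu vu vw =
    (p ∧ (uw xor nw)) xor (m xor (not p' ∧ ((nu xor vu) xor (nw xor vw))))

  top-crossings-at-neighbour : ∀ u v n t w → Walk (u ∷ n ∷ t) → end n t ≡ v → E u w →
    Avoids (pos u) (n ∷ t) → Avoids (pos w) (n ∷ t) →
    crossings true (u ∷ n ∷ t) (pos w) ≡
      local-parity (page u n) (page u w) (crossings true (n ∷ t) (pos u))
                   (pos u <ᵇ pos w) (pos n <ᵇ pos w) (pos n <ᵇ pos u) (pos v <ᵇ pos u) (pos v <ᵇ pos w)
  top-crossings-at-neighbour u v n t w (_ ∷ walk) refl uw u-off w-off =
    cong (covers true u n (pos w) xor_) (top-crossings-across-edge u w uw n t walk u-off w-off)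

  -- The Boolean identity behind the theta lemma: summing the local parities of
  -- the six pairs (i, j), the tail parities cancel and the rest is odd once the
  -- order relations are antisymmetric.
  theta-identity : ∀ p₁ p₂ p₃ m₁ m₂ m₃ u₁ u₂ u₃ n₁₂ n₁₃ n₂₃ vu v₁ v₂ v₃ →
    let c = λ pᵢ pⱼ mᵢ uⱼ nᵢⱼ uᵢ → local-parity pᵢ pⱼ mᵢ uⱼ nᵢⱼ (not uᵢ) vu in
    (c p₂ p₁ m₂ u₁ (not n₁₂) u₂ v₁ xor c p₃ p₁ m₃ u₁ (not n₁₃) u₃ v₁) xor
    ((c p₁ p₂ m₁ u₂ n₁₂ u₁ v₂ xor c p₃ p₂ m₃ u₂ (not n₂₃) u₃ v₂) xor
     (c p₁ p₃ m₁ u₃ n₁₃ u₁ v₃ xor c p₂ p₃ m₂ u₃ n₂₃ u₂ v₃)) ≡ true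
  theta-identity = solve 16 (λ p₁ p₂ p₃ m₁ m₂ m₃ u₁ u₂ u₃ n₁₂ n₁₃ n₂₃ vu v₁ v₂ v₃ →
    let ¬_ = λ x → con true :+ x
        c = λ pᵢ pⱼ mᵢ uⱼ nᵢⱼ uᵢ vⱼ →
              (pᵢ :* (uⱼ :+ nᵢⱼ)) :+ (mᵢ :+ ((¬ pⱼ) :* (((¬ uᵢ) :+ vu) :+ (nᵢⱼ :+ vⱼ))))
    in (c p₂ p₁ m₂ u₁ (¬ n₁₂) u₂ v₁ :+ c p₃ p₁ m₃ u₁ (¬ n₁₃) u₃ v₁) :+
       ((c p₁ p₂ m₁ u₂ n₁₂ u₁ v₂ :+ c p₃ p₂ m₃ u₂ (¬ n₂₃) u₃ v₂) :+
        (c p₁ p₃ m₁ u₃ n₁₃ u₁ v₃ :+ c p₂ p₃ m₂ u₃ n₂₃ u₂ v₃)) := con true) refl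

  first-edge : ∀ {u n t} → Walk (u ∷ n ∷ t) → E u n
  first-edge (un ∷ _) = un

  theta-parity : ∀ u v n₁ n₂ n₃ t₁ t₂ t₃ →
    Walk (u ∷ n₁ ∷ t₁) → Walk (u ∷ n₂ ∷ t₂) → Walk (u ∷ n₃ ∷ t₃) →
    end n₁ t₁ ≡ v → end n₂ t₂ ≡ v → end n₃ t₃ ≡ v →
    Avoids (pos u) (n₁ ∷ t₁) → Avoids (pos n₂) (n₁ ∷ t₁) → Avoids (pos n₃) (n₁ ∷ t₁) →
    Avoids (pos u) (n₂ ∷ t₂) → Avoids (pos n₁) (n₂ ∷ t₂) → Avoids (pos n₃) (n₂ ∷ t₂) →
    Avoids (pos u) (n₃ ∷ t₃) → Avoids (pos n₁) (n₃ ∷ t₃) → Avoids (pos n₂) (n₃ ∷ t₃) →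
    inside (u ∷ n₂ ∷ t₂) (u ∷ n₃ ∷ t₃) (pos n₁) xor
    (inside (u ∷ n₁ ∷ t₁) (u ∷ n₃ ∷ t₃) (pos n₂) xor inside (u ∷ n₁ ∷ t₁) (u ∷ n₂ ∷ t₂) (pos n₃)) ≡ true
  theta-parity u v n₁ n₂ n₃ t₁ t₂ t₃ P₁ P₂ P₃ end₁ end₂ end₃
               u∉₁ n₂∉₁ n₃∉₁ u∉₂ n₁∉₂ n₃∉₂ u∉₃ n₁∉₃ n₂∉₃
    rewrite top-crossings-at-neighbour u v n₁ t₁ n₂ P₁ end₁ (first-edge P₂) u∉₁ n₂∉₁
          | top-crossings-at-neighbour u v n₁ t₁ n₃ P₁ end₁ (first-edge P₃) u∉₁ n₃∉₁
          | top-crossings-at-neighbour u v n₂ t₂ n₁ P₂ end₂ (first-edge P₁) u∉₂ n₁∉₂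
          | top-crossings-at-neighbour u v n₂ t₂ n₃ P₂ end₂ (first-edge P₃) u∉₂ n₃∉₂
          | top-crossings-at-neighbour u v n₃ t₃ n₁ P₃ end₃ (first-edge P₁) u∉₃ n₁∉₃
          | top-crossings-at-neighbour u v n₃ t₃ n₂ P₃ end₃ (first-edge P₂) u∉₃ n₂∉₃
          | <ᵇ-flip (head n₂∉₁) | <ᵇ-flip (head n₃∉₁) | <ᵇ-flip (head n₃∉₂)
          | <ᵇ-flip (≢-sym (head u∉₁)) | <ᵇ-flip (≢-sym (head u∉₂)) | <ᵇ-flip (≢-sym (head u∉₃)) =
    theta-identity (page u n₁) (page u n₂) (page u n₃)
      (crossings true (n₁ ∷ t₁) (pos u)) (crossings true (n₂ ∷ t₂) (pos u)) (crossings true (n₃ ∷ t₃) (pos u))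
      (pos u <ᵇ pos n₁) (pos u <ᵇ pos n₂) (pos u <ᵇ pos n₃)
      (pos n₁ <ᵇ pos n₂) (pos n₁ <ᵇ pos n₃) (pos n₂ <ᵇ pos n₃)
      (pos v <ᵇ pos u) (pos v <ᵇ pos n₁) (pos v <ᵇ pos n₂) (pos v <ᵇ pos n₃)

module Expansion (G : Graph) where

  open import Data.Bool using (Bool; true; false; _∧_; _∨_; not; T)
  open import Data.Bool.Properties using (T-irrelevant)
  open import Data.Product using (Σ; _,_)
  open import Data.Empty using (⊥-elim)
  open import Relation.Nullary using (yes; no; does)
  open import Relation.Binary.PropositionalEquality

  Vertex : Set
  Vertex = V (completeExpansion G)

  base other : Vertex → V G
  base  (v , _ , _) = v
  other (_ , w , _) = w

  vertex-≡ : ∀ {v v' w w'} {p : T (adj G v w)} {p' : T (adj G v' w')} →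
             v ≡ v' → w ≡ w' → _≡_ {A = Vertex} (v , w , p) (v' , w' , p')
  vertex-≡ {v} {w = w} {p = p} {p'} refl refl = cong (λ r → v , w , r) (T-irrelevant p p')

  data Link (x y : Vertex) : Set where
    clique : base x ≡ base y → other x ≢ other y → Link x y
    ladder : base x ≡ other y → other x ≡ base y → Link x y

  link-sym : ∀ {x y} → Link x y → Link y x
  link-sym (clique b o) = clique (sym b) (λ e → o (sym e))
  link-sym (ladder b o) = ladder (sym o) (sym b)

  private
    same? : V G → V G → Bool
    same? x y = does (_≟_ G x y)

    same-true : ∀ {x y} → T (same? x y) → x ≡ y
    same-true {x} {y} t with _≟_ G x y
    ... | yes x≡y = x≡y

    same-false : ∀ {x y} → T (not (same? x y)) → x ≢ y
    same-false {x} {y} t with _≟_ G x y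
    ... | no x≢y = x≢y

    same-intro : ∀ {x y} → x ≡ y → T (same? x y)
    same-intro {x} {y} x≡y with _≟_ G x y
    ... | yes _   = _
    ... | no x≢y = x≢y x≡y

    differ-intro : ∀ {x y} → x ≢ y → T (not (same? x y))
    differ-intro {x} {y} x≢y with _≟_ G x y
    ... | yes x≡y = x≢y x≡y
    ... | no _    = _

    split-∧ : ∀ {a b} → T (a ∧ b) → Σ (T a) (λ _ → T b)
    split-∧ {true} {true} _ = _ , _

    join-∧ : ∀ {a b} → T a → T b → T (a ∧ b)
    join-∧ {true} {true} _ _ = _

  as-link : ∀ {x y} → T (adj (completeExpansion G) x y) → Link x y
  as-link {v , w , _} {v' , w' , _} t with same? v v' ∧ not (same? w w') in first
  ... | true  = let (s , d) = split-∧ (subst T (sym first) _) in clique (same-true s) (same-false d)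
  ... | false = let (s , s') = split-∧ t in ladder (same-true s) (same-true s')

  from-link : ∀ {x y} → Link x y → T (adj (completeExpansion G) x y)
  from-link {v , w , _} {v' , w' , _} (clique b o) with same? v v' ∧ not (same? w w') in first
  ... | true  = _
  ... | false = ⊥-elim (subst T first (join-∧ (same-intro b) (differ-intro o)))
  from-link {v , w , _} {v' , w' , _} (ladder b o) with same? v v' ∧ not (same? w w')
  ... | true  = _
  ... | false = join-∧ (same-intro b) (same-intro o)

  link-adj-sym : ∀ x y → T (adj (completeExpansion G) x y) → T (adj (completeExpansion G) y x)
  link-adj-sym x y t = from-link (link-sym (as-link {x} {y} t))

module Ladder (k : ℕ) where

  open import Data.Nat
  open import Data.Nat.Properties
  open import Data.Bool using (Bool; true; false; _∧_; _∨_; T)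
  open import Data.Bool.Properties using (T-∨; T-∧)
  open import Data.Product using (_,_)
  open import Data.Sum using (_⊎_; inj₁; inj₂; swap)
  open import Function.Bundles using (Equivalence)
  open import Relation.Binary.PropositionalEquality

  open Equivalence using (to)

  h m : ℕ
  h = 3 + k
  m = h + h

  -- The adjacency of mobius h on vertex indices: adj (mobius h) i j is
  -- definitionally adjacentℕ (toℕ i) (toℕ j).
  adjacentℕ : ℕ → ℕ → Bool
  adjacentℕ a b = (b ≡ᵇ a + 1) ∨ (a ≡ᵇ b + 1) ∨ ((a ≡ᵇ 0) ∧ (b ≡ᵇ (h + h) ∸ 1)) ∨
                  ((b ≡ᵇ 0) ∧ (a ≡ᵇ (h + h) ∸ 1)) ∨ (b ≡ᵇ a + h) ∨ (a ≡ᵇ b + h)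

  data Next (a b : ℕ) : Set where
    step : b ≡ suc a → Next a b
    wrap : b ≡ 0 → suc a ≡ m → Next a b

  Chord : ℕ → ℕ → Set
  Chord a b = b ≡ a + h ⊎ a ≡ b + h

  data Neighbour (a b : ℕ) : Set where
    forward  : Next a b → Neighbour a b
    backward : Next b a → Neighbour a b
    chord : Chord a b → Neighbour a b

  neighbour-sym : ∀ {a b} → Neighbour a b → Neighbour b a
  neighbour-sym (forward n)  = backward n
  neighbour-sym (backward n) = forward n
  neighbour-sym (chord c) = chord (swap c)

  private
    here : ∀ {x} y → T x → T (x ∨ y)
    here {true} y _ = _

    there : ∀ x {y} → T y → T (x ∨ y)
    there true  _ = _
    there false t = t

    both : ∀ {x y} → T x → T y → T (x ∧ y)
    both {true} {true} _ _ = _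

  neighbour-of : ∀ a b → T (adjacentℕ a b) → Neighbour a b
  neighbour-of a b t with to T-∨ t
  ... | inj₁ t₁ = forward (step (trans (≡ᵇ⇒≡ b (a + 1) t₁) (+-comm a 1)))
  ... | inj₂ t with to T-∨ t
  ... | inj₁ t₂ = backward (step (trans (≡ᵇ⇒≡ a (b + 1) t₂) (+-comm b 1)))
  ... | inj₂ t with to T-∨ t
  ... | inj₁ t₃ with to T-∧ t₃
  ...   | (a≡0 , b≡top) = backward (wrap (≡ᵇ⇒≡ a 0 a≡0) (cong suc (≡ᵇ⇒≡ b _ b≡top)))
  neighbour-of a b _ | inj₂ _ | inj₂ _ | inj₂ t with to T-∨ t
  ... | inj₁ t₄ with to T-∧ t₄
  ...   | (b≡0 , a≡top) = forward (wrap (≡ᵇ⇒≡ b 0 b≡0) (cong suc (≡ᵇ⇒≡ a _ a≡top)))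
  neighbour-of a b _ | inj₂ _ | inj₂ _ | inj₂ _ | inj₂ t with to T-∨ t
  ... | inj₁ t₅ = chord (inj₁ (≡ᵇ⇒≡ b (a + h) t₅))
  ... | inj₂ t₆ = chord (inj₂ (≡ᵇ⇒≡ a (b + h) t₆))

  adjacent-of : ∀ {a b} → Neighbour a b → T (adjacentℕ a b)
  adjacent-of {a} {b} (forward (step e)) =
    here _ (≡⇒≡ᵇ b (a + 1) (trans e (+-comm 1 a)))
  adjacent-of {a} {b} (backward (step e)) =
    there (b ≡ᵇ a + 1) (here _ (≡⇒≡ᵇ a (b + 1) (trans e (+-comm 1 b))))
  adjacent-of {a} {b} (backward (wrap a≡0 sb≡m)) =
    there (b ≡ᵇ a + 1) (there (a ≡ᵇ b + 1) (here _ (both (≡⇒≡ᵇ a 0 a≡0) (≡⇒≡ᵇ b _ (cong pred sb≡m)))))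
  adjacent-of {a} {b} (forward (wrap b≡0 sa≡m)) =
    there (b ≡ᵇ a + 1) (there (a ≡ᵇ b + 1) (there ((a ≡ᵇ 0) ∧ (b ≡ᵇ (h + h) ∸ 1))
      (here _ (both (≡⇒≡ᵇ b 0 b≡0) (≡⇒≡ᵇ a _ (cong pred sa≡m))))))
  adjacent-of {a} {b} (chord (inj₁ e)) =
    there (b ≡ᵇ a + 1) (there (a ≡ᵇ b + 1) (there ((a ≡ᵇ 0) ∧ (b ≡ᵇ (h + h) ∸ 1))
      (there ((b ≡ᵇ 0) ∧ (a ≡ᵇ (h + h) ∸ 1)) (here _ (≡⇒≡ᵇ b (a + h) e)))))
  adjacent-of {a} {b} (chord (inj₂ e)) =
    there (b ≡ᵇ a + 1) (there (a ≡ᵇ b + 1) (there ((a ≡ᵇ 0) ∧ (b ≡ᵇ (h + h) ∸ 1))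
      (there ((b ≡ᵇ 0) ∧ (a ≡ᵇ (h + h) ∸ 1)) (there (b ≡ᵇ a + h) (≡⇒≡ᵇ a (b + h) e)))))

module ThreePageEmbedding (k : ℕ) where

  open import Data.Nat
  open import Data.Nat.Properties
  open import Data.Nat.Divisibility using (_∣_; m∣m*n; ∣m+n∣m⇒∣n; ∣1⇒≡1)
  open import Data.Nat.Tactic.RingSolver using (solve-∀)
  open import Data.Bool using (true; false; if_then_else_; T)
  open import Data.Fin using (Fin; toℕ; #_)
  open import Data.Fin.Properties using (toℕ-injective; toℕ<n)
  open import Data.Product using (Σ; _×_; _,_)
  open import Data.Sum using (_⊎_; inj₁; inj₂; swap)
  open import Data.Empty using (⊥; ⊥-elim)
  open import Function using (case_of_; _$_)
  open import Relation.Nullary using (¬_; yes; no)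
  open import Relation.Binary.PropositionalEquality
  open import Relation.Binary.Definitions using (tri<; tri≈; tri>)
  open import Defs
  open Spine using (<ᵇ-true; <ᵇ-false)
  open Ladder k
  open Expansion (mobius h)

  three-halves : ∀ x → 3 * x ≡ x + (x + x)
  three-halves = solve-∀

  h<m : h < m
  h<m = m<m+n h (s≤s z≤n)

  -- Uniqueness of the neighbours of each kind; the hypotheses b < m exclude
  -- the index m, which the equations alone would allow.
  next-unique : ∀ {a b b'} → Next a b → Next a b' → b < m → b' < m → b ≡ b'
  next-unique (step e)    (step e')    _   _    = trans e (sym e')
  next-unique (step e)    (wrap _ sa)  b<m _    = ⊥-elim (<-irrefl (trans e sa) b<m)
  next-unique (wrap _ sa) (step e')    _   b'<m = ⊥-elim (<-irrefl (trans e' sa) b'<m)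
  next-unique (wrap e _)  (wrap e' _)  _   _    = trans e (sym e')

  previous-unique : ∀ {a b b'} → Next b a → Next b' a → b ≡ b'
  previous-unique (step e)     (step e')    = suc-injective (trans (sym e) e')
  previous-unique (step e)     (wrap a≡0 _) = ⊥-elim (0≢1+n (trans (sym a≡0) e))
  previous-unique (wrap a≡0 _) (step e')    = ⊥-elim (0≢1+n (trans (sym a≡0) e'))
  previous-unique (wrap _ sb)  (wrap _ sb') = suc-injective (trans sb (sym sb'))

  chord-up-and-down : ∀ {a b b'} → b ≡ a + h → a ≡ b' + h → b < m → ⊥
  chord-up-and-down {a} e e' b<m =
    <⇒≱ (+-cancelʳ-< h a h (subst (_< m) e b<m)) (subst (h ≤_) (sym e') (m≤n+m h _))

  chord-unique : ∀ {a b b'} → Chord a b → Chord a b' → b < m → b' < m → b ≡ b'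
  chord-unique (inj₁ e) (inj₁ e') _   _    = trans e (sym e')
  chord-unique (inj₂ e) (inj₂ e') _   _    = +-cancelʳ-≡ h _ _ (trans (sym e) e')
  chord-unique (inj₁ e) (inj₂ e') b<m _    = ⊥-elim (chord-up-and-down e e' b<m)
  chord-unique (inj₂ e) (inj₁ e') _   b'<m = ⊥-elim (chord-up-and-down e' e b'<m)

  next-not-chord : ∀ {a b} → Next a b → ¬ Chord a b
  next-not-chord {a} (step e) (inj₁ e') =
    case +-cancelˡ-≡ a 1 h (trans (+-comm a 1) (trans (sym e) e')) of λ ()
  next-not-chord {a} (step e) (inj₂ e') = m≢1+m+n a (trans e' (cong (_+ h) e))
  next-not-chord {a} (wrap b≡0 _) (inj₁ e') = case trans (sym b≡0) (trans e' (+-comm a h)) of λ ()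
  next-not-chord {a} (wrap b≡0 sa) (inj₂ e') =
    case +-cancelʳ-≡ h 1 h (trans (sym (cong suc (trans e' (cong (_+ h) b≡0)))) sa) of λ ()

  next-asym : ∀ {a b} → Next a b → ¬ Next b a
  next-asym {a} (step e) (step e') = <-irrefl (trans e' (cong suc e)) (<-trans (n<1+n a) (n<1+n (suc a)))
  next-asym (step e) (wrap a≡0 sb) = case trans (sym sb) (cong suc (trans e (cong suc a≡0))) of λ ()
  next-asym (wrap b≡0 sa) (step e') = case trans (sym sa) (cong suc (trans e' (cong suc b≡0))) of λ ()
  next-asym (wrap b≡0 sa) (wrap a≡0 _) = case trans (sym sa) (cong suc a≡0) of λ ()

  -- The triangle replacing ladder vertex a occupies the block
  -- of three consecutive positions 3 · block a, …; the blocks list the vertices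
  -- 0, 1, …, h - 1 and then 2h - 1, …, h, so that every chord a ~ a + h joins
  -- two blocks placed symmetrically about the middle of the spine.
  block : ℕ → ℕ
  block a = if a <ᵇ h then a else 3 * h ∸ suc a

  offset : ∀ {a b} → Neighbour a b → ℕ
  offset {a} (forward _)  = if a <ᵇ h then 2 else 0
  offset {a} (backward _) = if a <ᵇ h then 0 else 2
  offset     (chord _)    = 1

  block-low : ∀ {a} → a < h → block a ≡ a
  block-low a<h rewrite <ᵇ-true a<h = refl

  block-high : ∀ {a} → h ≤ a → a < m → block a + suc a ≡ 3 * h
  block-high {a} h≤a a<m rewrite <ᵇ-false h≤a =
    m∸n+n≡m (≤-trans a<m (subst (m ≤_) (sym (three-halves h)) (m≤n+m m h)))

  block-high-≥ : ∀ {a} → h ≤ a → a < m → h ≤ block a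
  block-high-≥ {a} h≤a a<m = +-cancelʳ-≤ (suc a) h (block a) (begin
    h + suc a ≤⟨ +-monoʳ-≤ h a<m ⟩
    h + m     ≡⟨ sym (three-halves h) ⟩
    3 * h     ≡⟨ sym (block-high h≤a a<m) ⟩
    block a + suc a ∎)
    where open ≤-Reasoning

  block-injective : ∀ {a a'} → a < m → a' < m → block a ≡ block a' → a ≡ a'
  block-injective {a} {a'} a<m a'<m e with a <? h | a' <? h
  ... | yes a<h | yes a'<h = trans (sym (block-low a<h)) (trans e (block-low a'<h))
  ... | yes a<h | no a'≮h  =
    ⊥-elim (<⇒≱ (subst (_< h) (trans (sym (block-low a<h)) e) a<h) (block-high-≥ (≮⇒≥ a'≮h) a'<m))
  ... | no a≮h  | yes a'<h =
    ⊥-elim (<⇒≱ (subst (_< h) (trans (sym (block-low a'<h)) (sym e)) a'<h) (block-high-≥ (≮⇒≥ a≮h) a<m))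
  ... | no a≮h  | no a'≮h  = suc-injective (+-cancelˡ-≡ (block a) _ _ (begin
    block a + suc a   ≡⟨ block-high (≮⇒≥ a≮h) a<m ⟩
    3 * h             ≡⟨ sym (block-high (≮⇒≥ a'≮h) a'<m) ⟩
    block a' + suc a' ≡⟨ cong (_+ suc a') (sym e) ⟩
    block a + suc a'  ∎))
    where open ≡-Reasoning

  offset<3 : ∀ {a b} (n : Neighbour a b) → offset n < 3
  offset<3 {a} (forward _) with a <ᵇ h
  ... | true  = s≤s (s≤s (s≤s z≤n))
  ... | false = s≤s z≤n
  offset<3 {a} (backward _) with a <ᵇ h
  ... | true  = s≤s z≤n
  ... | false = s≤s (s≤s (s≤s z≤n))
  offset<3 (chord _) = s≤s (s≤s z≤n)

  offset-unique : ∀ {a b} (n n' : Neighbour a b) → offset n ≡ offset n'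
  offset-unique (forward _)  (forward _)  = refl
  offset-unique (backward _) (backward _) = refl
  offset-unique (chord _)    (chord _)    = refl
  offset-unique (forward n)  (backward n') = ⊥-elim (next-asym n n')
  offset-unique (backward n) (forward n')  = ⊥-elim (next-asym n' n)
  offset-unique (forward n)  (chord c)     = ⊥-elim (next-not-chord n c)
  offset-unique (chord c)    (forward n)   = ⊥-elim (next-not-chord n c)
  offset-unique (backward n) (chord c)     = ⊥-elim (next-not-chord n (swap c))
  offset-unique (chord c)    (backward n)  = ⊥-elim (next-not-chord n (swap c))

  offset-injective : ∀ {a b b'} (n : Neighbour a b) (n' : Neighbour a b') →
                     b < m → b' < m → offset n ≡ offset n' → b ≡ b'
  offset-injective (forward x)  (forward y)  b<m b'<m _ = next-unique x y b<m b'<m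
  offset-injective (backward x) (backward y) _   _    _ = previous-unique x y
  offset-injective (chord x)    (chord y)    b<m b'<m _ = chord-unique x y b<m b'<m
  offset-injective {a} (forward _)  (backward _) _ _ e with a <ᵇ h
  ... | true  = case e of λ ()
  ... | false = case e of λ ()
  offset-injective {a} (backward _) (forward _)  _ _ e with a <ᵇ h
  ... | true  = case e of λ ()
  ... | false = case e of λ ()
  offset-injective {a} (forward _)  (chord _)    _ _ e with a <ᵇ h
  ... | true  = case e of λ ()
  ... | false = case e of λ ()
  offset-injective {a} (chord _)    (forward _)  _ _ e with a <ᵇ h
  ... | true  = case e of λ ()
  ... | false = case e of λ ()
  offset-injective {a} (backward _) (chord _)    _ _ e with a <ᵇ h
  ... | true  = case e of λ ()
  ... | false = case e of λ ()
  offset-injective {a} (chord _)    (backward _) _ _ e with a <ᵇ h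
  ... | true  = case e of λ ()
  ... | false = case e of λ ()

  quotient-order : ∀ {q q' r r'} → q < q' → r < 3 → 3 * q + r < 3 * q' + r'
  quotient-order {q} {q'} {r} {r'} q<q' r<3 = begin-strict
    3 * q + r     <⟨ +-monoʳ-< (3 * q) r<3 ⟩
    3 * q + 3     ≡⟨ +-comm (3 * q) 3 ⟩
    3 + 3 * q     ≡⟨ sym (*-suc 3 q) ⟩
    3 * suc q     ≤⟨ *-monoʳ-≤ 3 q<q' ⟩
    3 * q'        ≤⟨ m≤m+n (3 * q') r' ⟩
    3 * q' + r'   ∎
    where open ≤-Reasoning

  quotient-unique : ∀ {q q' r r'} → r < 3 → r' < 3 → 3 * q + r ≡ 3 * q' + r' → q ≡ q'
  quotient-unique {q} {q'} r<3 r'<3 e with <-cmp q q'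
  ... | tri< q<q' _ _ = ⊥-elim (<⇒≢ (quotient-order q<q' r<3) e)
  ... | tri≈ _ q≡q' _ = q≡q'
  ... | tri> _ _ q'<q = ⊥-elim (<⇒≢ (quotient-order q'<q r'<3) (sym e))

  facing : (x : Vertex) → Neighbour (toℕ (base x)) (toℕ (other x))
  facing (v , w , p) = neighbour-of (toℕ v) (toℕ w) p

  position : Vertex → ℕ
  position x = 3 * block (toℕ (base x)) + offset (facing x)

  position-injective : ∀ {x y} → position x ≡ position y → x ≡ y
  position-injective {x@(v , w , _)} {y@(v' , w' , _)} e
    with toℕ-injective (block-injective (toℕ<n v) (toℕ<n v')
           (quotient-unique (offset<3 (facing x)) (offset<3 (facing y)) e))
  ... | refl = vertex-≡ refl (toℕ-injective
      (offset-injective (facing x) (facing y) (toℕ<n w) (toℕ<n w')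
        (+-cancelˡ-≡ (3 * block (toℕ v)) _ _ e)))

  data Shape (lo hi : ℕ) : Set where
    adjacent : hi ≡ suc lo → Shape lo hi
    long     : ∀ q → lo ≡ 3 * q → hi ≡ 2 + lo → Shape lo hi   -- outer edge of a triangle
    first    : lo ≡ 0 → hi ≡ 3 * h → Shape lo hi              -- the ladder edge 0 ~ 2h - 1
    last     : suc lo ≡ 3 * h → suc hi ≡ 6 * h → Shape lo hi  -- the ladder edge h - 1 ~ h
    mirror   : lo < hi → lo + suc hi ≡ 6 * h → Shape lo hi    -- centred on the middle: chords

  Edge : ℕ → ℕ → Set
  Edge p q = Shape p q ⊎ Shape q p

  six-halves : ∀ x → 6 * x ≡ 3 * x + 3 * x
  six-halves = solve-∀

  shape-< : ∀ {lo hi} → Shape lo hi → lo < hi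
  shape-< {lo} (adjacent e)  = subst (lo <_) (sym e) (n<1+n lo)
  shape-< {lo} (long _ _ e)  = subst (lo <_) (sym e) (m<n+m lo (s≤s z≤n))
  shape-< (first refl refl)  = s≤s z≤n
  shape-< (last e e')        = s<s⁻¹ (subst₂ _<_ (sym e) (sym e')
    (subst (3 * h <_) (sym (six-halves h)) (m<m+n (3 * h) (s≤s z≤n))))
  shape-< (mirror lt _)      = lt

  -- Pages: the adjacent and mirror edges nest, the long and first edges are
  -- disjoint or nested, and the last edge is alone.
  shape-page : ∀ {lo hi} → Shape lo hi → Fin 3
  shape-page (adjacent _)   = # 0
  shape-page (mirror _ _)   = # 0
  shape-page (long _ _ _)   = # 1
  shape-page (first _ _)    = # 1
  shape-page (last _ _)     = # 2

  3h≢1 : 3 * h ≢ 1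
  3h≢1 ()

  3h≢2 : 3 * h ≢ 2
  3h≢2 ()

  multiple-of-3 : ∀ q q' → 3 * q ≢ suc (3 * q')
  multiple-of-3 q q' e = case ∣1⇒≡1 (∣m+n∣m⇒∣n three-divides (m∣m*n q')) of λ ()
    where
    three-divides : 3 ∣ 3 * q' + 1
    three-divides = subst (3 ∣_) (trans e (+-comm 1 (3 * q'))) (m∣m*n q)

  adjacent-long : ∀ {lo hi} → hi ≡ suc lo → hi ≡ 2 + lo → ⊥
  adjacent-long e e' = 1+n≢n (trans (sym e') e)

  adjacent-first : ∀ {lo hi} → hi ≡ suc lo → lo ≡ 0 → hi ≡ 3 * h → ⊥
  adjacent-first e refl e' = 3h≢1 (trans (sym e') e)

  adjacent-last : ∀ {lo hi} → hi ≡ suc lo → suc lo ≡ 3 * h → suc hi ≡ 6 * h → ⊥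
  adjacent-last refl e₁ e₂ = 3h≢1 (+-cancelʳ-≡ (3 * h) (3 * h) 1
    (trans (sym (six-halves h)) (trans (sym e₂) (cong suc e₁))))

  long-last : ∀ {lo hi} → hi ≡ 2 + lo → suc lo ≡ 3 * h → suc hi ≡ 6 * h → ⊥
  long-last refl e₁ e₂ = 3h≢2 (+-cancelʳ-≡ (3 * h) (3 * h) 2
    (trans (sym (six-halves h)) (trans (sym e₂) (cong (2 +_) e₁))))

  long-mirror : ∀ {lo hi} → hi ≡ 2 + lo → lo + suc hi ≡ 6 * h → ⊥
  long-mirror {lo} refl e = even≢odd (3 * h) (lo + 1) (trans (twice-three h) (trans (sym e) (odd lo)))
    where
    twice-three : ∀ x → 2 * (3 * x) ≡ 6 * x
    twice-three = solve-∀
    odd : ∀ lo → lo + suc (2 + lo) ≡ suc (2 * (lo + 1))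
    odd = solve-∀

  first-last : ∀ {lo} → lo ≡ 0 → suc lo ≡ 3 * h → ⊥
  first-last refl e = 3h≢1 (sym e)

  first-mirror : ∀ {lo hi} → lo ≡ 0 → hi ≡ 3 * h → lo + suc hi ≡ 6 * h → ⊥
  first-mirror refl refl e = 3h≢1 (+-cancelʳ-≡ (3 * h) (3 * h) 1 (trans (sym (six-halves h)) (sym e)))

  last-mirror : ∀ {lo hi} → suc lo ≡ 3 * h → suc hi ≡ 6 * h → lo + suc hi ≡ 6 * h → ⊥
  last-mirror {lo} e₁ e₂ e = 3h≢1 (trans (sym e₁) (cong suc lo≡0))
    where
    lo≡0 : lo ≡ 0
    lo≡0 = +-cancelʳ-≡ (6 * h) lo 0 (trans (cong (lo +_) (sym e₂)) e)

  shape-page-unique : ∀ {lo hi} (s s' : Shape lo hi) → shape-page s ≡ shape-page s'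
  shape-page-unique (adjacent _)   (adjacent _)   = refl
  shape-page-unique (adjacent _)   (mirror _ _)   = refl
  shape-page-unique (mirror _ _)   (adjacent _)   = refl
  shape-page-unique (mirror _ _)   (mirror _ _)   = refl
  shape-page-unique (long _ _ _)   (long _ _ _)   = refl
  shape-page-unique (long _ _ _)   (first _ _)    = refl
  shape-page-unique (first _ _)    (long _ _ _)   = refl
  shape-page-unique (first _ _)    (first _ _)    = refl
  shape-page-unique (last _ _)     (last _ _)     = refl
  shape-page-unique (adjacent e)   (long _ _ e')  = ⊥-elim (adjacent-long e e')
  shape-page-unique (long _ _ e')  (adjacent e)   = ⊥-elim (adjacent-long e e')
  shape-page-unique (adjacent e)   (first e₀ e')  = ⊥-elim (adjacent-first e e₀ e')
  shape-page-unique (first e₀ e')  (adjacent e)   = ⊥-elim (adjacent-first e e₀ e')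
  shape-page-unique (adjacent e)   (last e₁ e₂)   = ⊥-elim (adjacent-last e e₁ e₂)
  shape-page-unique (last e₁ e₂)   (adjacent e)   = ⊥-elim (adjacent-last e e₁ e₂)
  shape-page-unique (long _ _ e)   (last e₁ e₂)   = ⊥-elim (long-last e e₁ e₂)
  shape-page-unique (last e₁ e₂)   (long _ _ e)   = ⊥-elim (long-last e e₁ e₂)
  shape-page-unique (long _ _ e)   (mirror _ e')  = ⊥-elim (long-mirror e e')
  shape-page-unique (mirror _ e')  (long _ _ e)   = ⊥-elim (long-mirror e e')
  shape-page-unique (first e₀ _)   (last e₁ _)    = ⊥-elim (first-last e₀ e₁)
  shape-page-unique (last e₁ _)    (first e₀ _)   = ⊥-elim (first-last e₀ e₁)
  shape-page-unique (first e₀ e)   (mirror _ e')  = ⊥-elim (first-mirror e₀ e e')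
  shape-page-unique (mirror _ e')  (first e₀ e)   = ⊥-elim (first-mirror e₀ e e')
  shape-page-unique (last e₁ e₂)   (mirror _ e')  = ⊥-elim (last-mirror e₁ e₂ e')
  shape-page-unique (mirror _ e')  (last e₁ e₂)   = ⊥-elim (last-mirror e₁ e₂ e')

  shapes-do-not-cross : ∀ {a b c d} (s : Shape a b) (s' : Shape c d) → shape-page s ≡ shape-page s' →
                        a < c → c < b → b < d → ⊥
  shapes-do-not-cross {a} (adjacent e) _ _ a<c c<b _ = <⇒≱ a<c (s≤s⁻¹ (subst (_ <_) e c<b))
  shapes-do-not-cross (mirror _ _) (adjacent e) _ _ c<b b<d = <⇒≱ c<b (s≤s⁻¹ (subst (_ <_) e b<d))
  shapes-do-not-cross {a} {b} {c} {d} (mirror _ e) (mirror _ e') _ a<c _ b<d =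
    <⇒≢ (+-mono-< a<c (s≤s b<d)) (trans e (sym e'))
  shapes-do-not-cross (long q refl refl) (long q' refl _) _ a<c c<b _ =
    multiple-of-3 q' q (≤-antisym (s≤s⁻¹ c<b) a<c)
  shapes-do-not-cross (long _ _ _) (first refl _) _ () _ _
  shapes-do-not-cross (first refl refl) (long q' refl refl) _ _ c<b b<d =
    multiple-of-3 h q' (≤-antisym (s≤s⁻¹ b<d) c<b)
  shapes-do-not-cross (first refl _) (first refl _) _ () _ _
  shapes-do-not-cross (last e _) (last e' _) _ a<c _ _ = <⇒≢ a<c (suc-injective (trans e (sym e')))
  shapes-do-not-cross (long _ _ _) (adjacent _) ()
  shapes-do-not-cross (long _ _ _) (mirror _ _) ()
  shapes-do-not-cross (long _ _ _) (last _ _)   ()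
  shapes-do-not-cross (first _ _)  (adjacent _) ()
  shapes-do-not-cross (first _ _)  (mirror _ _) ()
  shapes-do-not-cross (first _ _)  (last _ _)   ()
  shapes-do-not-cross (last _ _)   (adjacent _) ()
  shapes-do-not-cross (last _ _)   (long _ _ _) ()
  shapes-do-not-cross (last _ _)   (first _ _)  ()
  shapes-do-not-cross (last _ _)   (mirror _ _) ()
  shapes-do-not-cross (mirror _ _) (long _ _ _) ()
  shapes-do-not-cross (mirror _ _) (first _ _)  ()
  shapes-do-not-cross (mirror _ _) (last _ _)   ()

  outer : ∀ B → 3 * B + 2 ≡ 2 + (3 * B + 0)
  outer = solve-∀

  triangle-shape : ∀ B {o o'} → o < 3 → o' < 3 → o ≢ o' → Edge (3 * B + o) (3 * B + o')
  triangle-shape B (s≤s z≤n)             (s≤s (s≤s z≤n))       _ = inj₁ (adjacent (+-suc (3 * B) 0))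
  triangle-shape B (s≤s (s≤s z≤n))       (s≤s z≤n)             _ = inj₂ (adjacent (+-suc (3 * B) 0))
  triangle-shape B (s≤s (s≤s z≤n))       (s≤s (s≤s (s≤s z≤n))) _ = inj₁ (adjacent (+-suc (3 * B) 1))
  triangle-shape B (s≤s (s≤s (s≤s z≤n))) (s≤s (s≤s z≤n))       _ = inj₂ (adjacent (+-suc (3 * B) 1))
  triangle-shape B (s≤s z≤n)             (s≤s (s≤s (s≤s z≤n))) _ = inj₁ (long B (+-identityʳ (3 * B)) (outer B))
  triangle-shape B (s≤s (s≤s (s≤s z≤n))) (s≤s z≤n)             _ = inj₂ (long B (+-identityʳ (3 * B)) (outer B))
  triangle-shape B (s≤s z≤n)             (s≤s z≤n)             o≢o = ⊥-elim (o≢o refl)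
  triangle-shape B (s≤s (s≤s z≤n))       (s≤s (s≤s z≤n))       o≢o = ⊥-elim (o≢o refl)
  triangle-shape B (s≤s (s≤s (s≤s z≤n))) (s≤s (s≤s (s≤s z≤n))) o≢o = ⊥-elim (o≢o refl)

  next-block : ∀ X → 3 * suc X + 0 ≡ suc (3 * X + 2)
  next-block = solve-∀

  nine-halves : ∀ x → 3 * (3 * x) ≡ 6 * x + 3 * x
  nine-halves = solve-∀

  last-block : ∀ {X} → X + suc h ≡ 3 * h → suc (3 * X + 2) ≡ 6 * h
  last-block {X} e = +-cancelʳ-≡ (3 * h) _ _ (begin
    suc (3 * X + 2) + 3 * h ≡⟨ regroup X h ⟩
    3 * (X + suc h)         ≡⟨ cong (3 *_) e ⟩
    3 * (3 * h)             ≡⟨ nine-halves h ⟩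
    6 * h + 3 * h           ∎)
    where
    open ≡-Reasoning
    regroup : ∀ X h → suc (3 * X + 2) + 3 * h ≡ 3 * (X + suc h)
    regroup = solve-∀

  mirror-blocks : ∀ {X Y} → X + suc (Y + h) ≡ 3 * h → (3 * Y + 1) + suc (3 * X + 1) ≡ 6 * h
  mirror-blocks {X} {Y} e = +-cancelʳ-≡ (3 * h) _ _ (begin
    (3 * Y + 1) + suc (3 * X + 1) + 3 * h ≡⟨ regroup X Y h ⟩
    3 * (X + suc (Y + h))                 ≡⟨ cong (3 *_) e ⟩
    3 * (3 * h)                           ≡⟨ nine-halves h ⟩
    6 * h + 3 * h                         ∎)
    where
    open ≡-Reasoning
    regroup : ∀ X Y h → (3 * Y + 1) + suc (3 * X + 1) + 3 * h ≡ 3 * (X + suc (Y + h))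
    regroup = solve-∀

  forward-low : ∀ {a b} {n : Next a b} → a < h → offset (forward n) ≡ 2
  forward-low a<h rewrite <ᵇ-true a<h = refl

  forward-high : ∀ {a b} {n : Next a b} → h ≤ a → offset (forward n) ≡ 0
  forward-high h≤a rewrite <ᵇ-false h≤a = refl

  backward-low : ∀ {a b} {n : Next b a} → a < h → offset (backward n) ≡ 0
  backward-low a<h rewrite <ᵇ-true a<h = refl

  backward-high : ∀ {a b} {n : Next b a} → h ≤ a → offset (backward n) ≡ 2
  backward-high h≤a rewrite <ᵇ-false h≤a = refl

  at : ∀ {B B' o o'} → B ≡ B' → o ≡ o' → 3 * B + o ≡ 3 * B' + o'
  at = cong₂ (λ x y → 3 * x + y)

  edge-≡ : ∀ {p p' q q'} → p ≡ p' → q ≡ q' → Edge p' q' → Edge p q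
  edge-≡ refl refl e = e

  next-shape : ∀ {a b} → a < m → b < m → (n : Next a b) →
               Edge (3 * block a + offset (forward n)) (3 * block b + offset {b} {a} (backward n))
  next-shape {a} {b} a<m b<m (step e) with a <? h | b <? h
  ... | yes a<h | yes b<h =
    edge-≡ (at (block-low a<h) (forward-low {n = step e} a<h))
           (at (trans (block-low b<h) e) (backward-low {n = step e} b<h))
      (inj₁ (adjacent (next-block a)))
  ... | yes a<h | no b≮h =
    edge-≡ (at (block-low a<h) (forward-low {n = step e} a<h))
           (cong (3 * block b +_) (backward-high {n = step e} (≮⇒≥ b≮h)))
      (inj₁ (last (trans (sym (next-block a)) (trans (cong (λ z → 3 * z + 0) (trans (sym e) b≡h)) (+-identityʳ _)))
                  (last-block (subst (λ z → block b + suc z ≡ 3 * h) b≡h (block-high (≮⇒≥ b≮h) b<m)))))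
    where
    b≡h : b ≡ h
    b≡h = ≤-antisym (subst (_≤ h) (sym e) a<h) (≮⇒≥ b≮h)
  ... | no a≮h | yes b<h = ⊥-elim (<⇒≱ b<h (subst (h ≤_) (sym e) (≤-trans (≮⇒≥ a≮h) (n≤1+n a))))
  ... | no a≮h | no b≮h =
    edge-≡ (at successive (forward-high {n = step e} (≮⇒≥ a≮h)))
           (cong (3 * block b +_) (backward-high {n = step e} (≮⇒≥ b≮h)))
      (inj₂ (adjacent (next-block (block b))))
    where
    successive : block a ≡ suc (block b)
    successive = +-cancelʳ-≡ (suc a) _ _ (begin
      block a + suc a       ≡⟨ block-high (≮⇒≥ a≮h) a<m ⟩
      3 * h                 ≡⟨ sym (block-high (≮⇒≥ b≮h) b<m) ⟩
      block b + suc b       ≡⟨ cong (λ z → block b + suc z) e ⟩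
      block b + suc (suc a) ≡⟨ +-suc (block b) (suc a) ⟩
      suc (block b) + suc a ∎)
      where open ≡-Reasoning
  next-shape {a} a<m _ (wrap refl sa) =
    edge-≡ (at block-a≡h (forward-high {n = wrap refl sa} h≤a)) refl (inj₂ (first refl (+-identityʳ _)))
    where
    h≤a : h ≤ a
    h≤a = s≤s⁻¹ (subst (h <_) (sym sa) h<m)
    block-a≡h : block a ≡ h
    block-a≡h = +-cancelʳ-≡ m _ _ (begin
      block a + m     ≡⟨ cong (block a +_) (sym sa) ⟩
      block a + suc a ≡⟨ block-high h≤a a<m ⟩
      3 * h           ≡⟨ three-halves h ⟩
      h + m           ∎)
      where open ≡-Reasoning

  chord-low : ∀ {a b} → b < m → b ≡ a + h → a < h
  chord-low {a} b<m e = +-cancelʳ-< h a h (subst (_< m) e b<m)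

  chord-shape : ∀ {a b} → b < m → b ≡ a + h → Edge (3 * block a + 1) (3 * block b + 1)
  chord-shape {a} {b} b<m e = edge-≡ (cong (λ z → 3 * z + 1) (block-low a<h)) refl $
    inj₁ (mirror (quotient-order (<-≤-trans a<h (block-high-≥ h≤b b<m)) (s≤s (s≤s z≤n)))
                 (mirror-blocks (subst (λ z → block b + suc z ≡ 3 * h) e (block-high h≤b b<m))))
    where
    a<h : a < h
    a<h = chord-low b<m e
    h≤b : h ≤ b
    h≤b = subst (h ≤_) (sym e) (m≤n+m h a)

  ladder-shape : ∀ {a b} → a < m → b < m → (n : Neighbour a b) →
                 Edge (3 * block a + offset n) (3 * block b + offset (neighbour-sym n))
  ladder-shape a<m b<m (forward n)       = next-shape a<m b<m n
  ladder-shape a<m b<m (backward n)      = swap (next-shape b<m a<m n)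
  ladder-shape a<m b<m (chord (inj₁ e))  = chord-shape b<m e
  ladder-shape a<m b<m (chord (inj₂ e))  = swap (chord-shape a<m e)

  edge-page : ∀ {p q} → Edge p q → Fin 3
  edge-page (inj₁ s) = shape-page s
  edge-page (inj₂ s) = shape-page s

  edge-page-sym : ∀ {p q} (e : Edge p q) (e' : Edge q p) → edge-page e ≡ edge-page e'
  edge-page-sym (inj₁ s) (inj₁ s') = ⊥-elim (<-asym (shape-< s) (shape-< s'))
  edge-page-sym (inj₁ s) (inj₂ s') = shape-page-unique s s'
  edge-page-sym (inj₂ s) (inj₁ s') = shape-page-unique s s'
  edge-page-sym (inj₂ s) (inj₂ s') = ⊥-elim (<-asym (shape-< s) (shape-< s'))

  oriented : ∀ {p q} → p < q → (e : Edge p q) → Σ (Shape p q) (λ s → edge-page e ≡ shape-page s)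
  oriented _   (inj₁ s) = s , refl
  oriented p<q (inj₂ s) = ⊥-elim (<-asym p<q (shape-< s))

  edge-shape : ∀ x y → T (adj (completeExpansion (mobius h)) x y) → Edge (position x) (position y)
  edge-shape x y p with as-link {x} {y} p
  edge-shape (v , w , p) (v , w' , p') _ | clique refl w≢w' =
    triangle-shape (block (toℕ v)) (offset<3 (facing (v , w , p))) (offset<3 (facing (v , w' , p')))
      (λ e → w≢w' (toℕ-injective
        (offset-injective (facing (v , w , p)) (facing (v , w' , p')) (toℕ<n w) (toℕ<n w') e)))
  edge-shape (v , w , p) (w , v , p') _ | ladder refl refl =
    edge-≡ refl
      (cong (3 * block (toℕ w) +_) (offset-unique (facing (w , v , p')) (neighbour-sym (facing (v , w , p)))))
      (ladder-shape (toℕ<n v) (toℕ<n w) (facing (v , w , p)))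

  three-page-embedding : BookEmbedding (completeExpansion (mobius h)) 3
  three-page-embedding = position , position-injective , page , page-sym , no-crossing
    where
    page : (x y : Vertex) → T (adj (completeExpansion (mobius h)) x y) → Fin 3
    page x y p = edge-page (edge-shape x y p)
    page-sym : ∀ x y p q → page x y p ≡ page y x q
    page-sym x y p q = edge-page-sym (edge-shape x y p) (edge-shape y x q)
    no-crossing : ∀ a b c d p q → page a b p ≡ page c d q →
                  ¬ (position a < position c × position c < position b × position b < position d)
    no-crossing a b c d p q same (a<c , c<b , b<d)
      with oriented (<-trans a<c c<b) (edge-shape a b p) | oriented (<-trans c<b b<d) (edge-shape c d q)
    ... | s , page-s | s' , page-s' =
      shapes-do-not-cross s s' (trans (sym page-s) (trans same page-s')) a<c c<b b<d

-- Ladder indices modulo 2h, the copies R s, L s, X s of ladder vertices in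
-- E_c(M_h), and the rim: the cycle R 0, L 0, R 1, L 1, …, R (2h - 1), L (2h - 1).
module Rim (k : ℕ) where

  open import Data.Nat
  open import Data.Nat.Properties
  open import Data.Nat.DivMod
  open import Data.Bool using (T)
  open import Data.Fin using (Fin; toℕ; fromℕ<)
  open import Data.Fin.Properties using (toℕ-injective; toℕ-fromℕ<)
  open import Data.Product using (_×_; _,_; proj₁; proj₂)
  open import Data.Sum using (inj₁; inj₂)
  open import Data.List using (List; []; _∷_; _++_)
  open import Data.List.Relation.Unary.All using (All; []; _∷_)
  open import Data.List.Relation.Unary.Linked using (Linked; [-]; _∷_)
  open import Function using (_$_)
  open import Relation.Nullary using (¬_; yes; no)
  open import Relation.Binary.PropositionalEquality
  open import Relation.Binary.Definitions using (tri<; tri≈; tri>)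
  open import Defs
  open Ladder k
  open Expansion (mobius h)
  open Walks using (end)

  infix 4 _≡ₘ_
  record _≡ₘ_ (s t : ℕ) : Set where
    constructor residues
    field residues-≡ : s % m ≡ t % m
  open _≡ₘ_

  ≡ₘ-sym : ∀ {s t} → s ≡ₘ t → t ≡ₘ s
  ≡ₘ-sym (residues e) = residues (sym e)

  ≡ₘ-trans : ∀ {s t u} → s ≡ₘ t → t ≡ₘ u → s ≡ₘ u
  ≡ₘ-trans (residues e) (residues e') = residues (trans e e')

  ≡⇒≡ₘ : ∀ {s t} → s ≡ t → s ≡ₘ t
  ≡⇒≡ₘ refl = residues refl

  apart : ∀ {s t} → s < t → t < s + m → ¬ s ≡ₘ t
  apart {s} {t} s<t t<s+m (residues same) = <⇒≱ t<s+m s+m≤t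
    where
    open ≤-Reasoning
    r : ℕ
    r = s % m
    t≡ : t ≡ r + (t / m) * m
    t≡ = trans (m≡m%n+[m/n]*n t m) (cong (_+ (t / m) * m) (sym same))
    s≡ : s ≡ r + (s / m) * m
    s≡ = m≡m%n+[m/n]*n s m
    quotients : s / m < t / m
    quotients = ≰⇒> λ t/m≤s/m → <⇒≱ s<t (begin
      t                 ≡⟨ t≡ ⟩
      r + (t / m) * m   ≤⟨ +-monoʳ-≤ r (*-monoˡ-≤ m t/m≤s/m) ⟩
      r + (s / m) * m   ≡⟨ sym s≡ ⟩
      s                 ∎)
    s+m≤t : s + m ≤ t
    s+m≤t = begin
      s + m                   ≡⟨ cong (_+ m) s≡ ⟩
      r + (s / m) * m + m     ≡⟨ +-assoc r _ m ⟩
      r + ((s / m) * m + m)   ≡⟨ cong (r +_) (+-comm _ m) ⟩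
      r + suc (s / m) * m     ≤⟨ +-monoʳ-≤ r (*-monoˡ-≤ m quotients) ⟩
      r + (t / m) * m         ≡⟨ sym t≡ ⟩
      t                       ∎

  window : ∀ {a s t} → a ≤ s → a ≤ t → s < a + m → t < a + m → s ≢ t → ¬ s ≡ₘ t
  window {a} {s} {t} a≤s a≤t s<am t<am s≢t with <-cmp s t
  ... | tri< s<t _ _ = apart s<t (<-≤-trans t<am (+-monoˡ-≤ m a≤s))
  ... | tri≈ _ s≡t _ = λ _ → s≢t s≡t
  ... | tri> _ _ t<s = λ e → apart t<s (<-≤-trans s<am (+-monoˡ-≤ m a≤t)) (≡ₘ-sym e)

  separate : ∀ {a s t} → a ≤ s → s < t → t < a + m → ¬ s ≡ₘ t
  separate a≤s s<t t<am = window a≤s (≤-trans a≤s (<⇒≤ s<t)) (<-trans s<t t<am) t<am (<⇒≢ s<t)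

  separate′ : ∀ {a s t} → a ≤ s → s < t → t < a + m → ¬ t ≡ₘ s
  separate′ a≤s s<t t<am e = separate a≤s s<t t<am (≡ₘ-sym e)

  +ₘ-congˡ : ∀ c {a b} → a ≡ₘ b → c + a ≡ₘ c + b
  +ₘ-congˡ c {a} {b} (residues e) = residues $ begin
    (c + a) % m             ≡⟨ %-distribˡ-+ c a m ⟩
    (c % m + a % m) % m     ≡⟨ cong (λ z → (c % m + z) % m) e ⟩
    (c % m + b % m) % m     ≡⟨ sym (%-distribˡ-+ c b m) ⟩
    (c + b) % m             ∎
    where open ≡-Reasoning

  +ₘ-congʳ : ∀ c {a b} → a ≡ₘ b → a + c ≡ₘ b + c
  +ₘ-congʳ c {a} {b} e =
    ≡ₘ-trans (≡⇒≡ₘ (+-comm a c)) (≡ₘ-trans (+ₘ-congˡ c e) (≡⇒≡ₘ (+-comm c b)))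

  reduce : ∀ s → s % m ≡ₘ s
  reduce s = residues (m%n%n≡m%n s m)

  +m-≡ₘ : ∀ s → s + m ≡ₘ s
  +m-≡ₘ s = residues ([m+n]%n≡m%n s m)

  next-mod : ∀ s → Next (s % m) (suc s % m)
  next-mod s with suc (s % m) <? m
  ... | yes below = step (trans (residues-≡ (+ₘ-congˡ 1 (≡ₘ-sym (reduce s)))) (m<n⇒m%n≡m below))
  ... | no ¬below =
    wrap (trans (residues-≡ (+ₘ-congˡ 1 (≡ₘ-sym (reduce s)))) (trans (cong (_% m) top) (n%n≡0 m))) top
    where
    top : suc (s % m) ≡ m
    top = ≤-antisym (m%n<n s m) (≮⇒≥ ¬below)

  chord-mod : ∀ s → Chord (s % m) ((s + h) % m)
  chord-mod s with s % m <? h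
  ... | yes r<h = inj₁ (trans shift (m<n⇒m%n≡m (+-monoˡ-< h r<h)))
    where
    shift : (s + h) % m ≡ (s % m + h) % m
    shift = residues-≡ (+ₘ-congʳ h (≡ₘ-sym (reduce s)))
  ... | no r≮h = inj₂ (sym (trans (cong (_+ h) wrapped) (m∸n+n≡m h≤r)))
    where
    h≤r : h ≤ s % m
    h≤r = ≮⇒≥ r≮h
    wrapped : (s + h) % m ≡ s % m ∸ h
    wrapped = begin
      (s + h) % m              ≡⟨ residues-≡ (+ₘ-congʳ h (≡ₘ-sym (reduce s))) ⟩
      (s % m + h) % m          ≡⟨ cong (λ z → (z + h) % m) (sym (m∸n+n≡m h≤r)) ⟩
      (s % m ∸ h + h + h) % m  ≡⟨ cong (_% m) (+-assoc (s % m ∸ h) h h) ⟩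
      (s % m ∸ h + m) % m      ≡⟨ [m+n]%n≡m%n (s % m ∸ h) m ⟩
      (s % m ∸ h) % m          ≡⟨ m<n⇒m%n≡m (≤-<-trans (m∸n≤m (s % m) h) (m%n<n s m)) ⟩
      s % m ∸ h                ∎
      where open ≡-Reasoning

  fin : ℕ → Fin m
  fin t = fromℕ< (m%n<n t m)

  toℕ-fin : ∀ t → toℕ (fin t) ≡ t % m
  toℕ-fin t = toℕ-fromℕ< (m%n<n t m)

  fin-≡ : ∀ {s t} → s ≡ₘ t → fin s ≡ fin t
  fin-≡ {s} {t} (residues e) = toℕ-injective (trans (toℕ-fin s) (trans e (sym (toℕ-fin t))))

  copy : ∀ i j → Neighbour (i % m) (j % m) → Vertex
  copy i j n = fin i , fin j , adjacent-of (subst₂ Neighbour (sym (toℕ-fin i)) (sym (toℕ-fin j)) n)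

  R L X : ℕ → Vertex
  R s = copy s (suc s) (forward (next-mod s))
  L s = copy (suc s) s (backward (next-mod s))
  X s = copy s (s + h) (chord (chord-mod s))

  copy-≡ : ∀ {i j i' j' n n'} → i ≡ₘ i' → j ≡ₘ j' → copy i j n ≡ copy i' j' n'
  copy-≡ ei ej = vertex-≡ (fin-≡ ei) (fin-≡ ej)

  copy-indices : ∀ i j i' j' {n n'} → copy i j n ≡ copy i' j' n' → i ≡ₘ i' × j ≡ₘ j'
  copy-indices i j i' j' e =
    residues (trans (sym (toℕ-fin i)) (trans (cong (λ x → toℕ (base x)) e) (toℕ-fin i'))) ,
    residues (trans (sym (toℕ-fin j)) (trans (cong (λ x → toℕ (other x)) e) (toℕ-fin j')))

  R-cong : ∀ {s t} → s ≡ₘ t → R s ≡ R t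
  R-cong e = copy-≡ e (+ₘ-congˡ 1 e)

  L-cong : ∀ {s t} → s ≡ₘ t → L s ≡ L t
  L-cong e = copy-≡ (+ₘ-congˡ 1 e) e

  X-cong : ∀ {s t} → s ≡ₘ t → X s ≡ X t
  X-cong e = copy-≡ e (+ₘ-congʳ h e)

  1<h : 1 < h
  1<h = s≤s (s≤s z≤n)

  2<m : 2 < m
  2<m = s≤s (s≤s (s≤s z≤n))

  h<m : h < m
  h<m = m<m+n h (s≤s z≤n)

  R≢L : ∀ s t → R s ≢ L t
  R≢L s t e with copy-indices s (suc s) (suc t) t e
  ... | s≡1+t , 1+s≡t = apart (m<n+m t (s≤s z≤n)) (subst (_< t + m) (+-comm t 2) (+-monoʳ-< t 2<m))
                          (≡ₘ-sym (≡ₘ-trans (+ₘ-congˡ 1 (≡ₘ-sym s≡1+t)) 1+s≡t))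

  X≢R : ∀ s t → X s ≢ R t
  X≢R s t e with copy-indices s (s + h) t (suc t) e
  ... | s≡t , s+h≡1+t = apart (subst (_< s + h) (+-comm s 1) (+-monoʳ-< s 1<h))
                               (<-trans (+-monoʳ-< s h<m) (n<1+n (s + m)))
                          (≡ₘ-trans (+ₘ-congˡ 1 s≡t) (≡ₘ-sym s+h≡1+t))

  X≢L : ∀ s t → X s ≢ L t
  X≢L s t e with copy-indices s (s + h) (suc t) t e
  ... | s≡1+t , s+h≡t = apart (s≤s (m≤m+n s h))
                               (subst (_< s + m) (+-suc s h) (+-monoʳ-< s (subst (_< m) (+-comm h 1) (+-monoʳ-< h 1<h))))
                          (≡ₘ-trans s≡1+t (≡ₘ-sym (+ₘ-congˡ 1 s+h≡t)))

  Adjacent : Vertex → Vertex → Set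
  Adjacent x y = T (adj (completeExpansion (mobius h)) x y)

  fin-≢ : ∀ {s t} → ¬ s ≡ₘ t → fin s ≢ fin t
  fin-≢ {s} {t} s≢t e = s≢t (residues (trans (sym (toℕ-fin s)) (trans (cong toℕ e) (toℕ-fin t))))

  R-L : ∀ s → Adjacent (R s) (L s)
  R-L s = from-link {R s} {L s} (ladder refl refl)

  L-R : ∀ s → Adjacent (L s) (R (suc s))
  L-R s = from-link {L s} {R (suc s)} (clique refl (fin-≢ (apart (m<n+m s (s≤s z≤n))
    (subst (_< s + m) (+-comm s 2) (+-monoʳ-< s 2<m)))))

  R-X : ∀ s → Adjacent (R s) (X s)
  R-X s = from-link {R s} {X s} (clique refl (fin-≢ (apart
    (subst (_< s + h) (+-comm s 1) (+-monoʳ-< s 1<h)) (<-trans (+-monoʳ-< s h<m) (n<1+n (s + m))))))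

  X-X : ∀ s → Adjacent (X s) (X (s + h))
  X-X s = from-link {X s} {X (s + h)}
    (ladder (fin-≡ (≡ₘ-sym (≡ₘ-trans (≡⇒≡ₘ (+-assoc s h h)) (+m-≡ₘ s)))) refl)

  adjacent-sym : ∀ x y → Adjacent x y → Adjacent y x
  adjacent-sym = link-adj-sym

  rim-tail : ℕ → ℕ → List Vertex
  rim-tail s zero    = []
  rim-tail s (suc j) = L s ∷ R (suc s) ∷ rim-tail (suc s) j

  rim-walk : ∀ s j → Linked Adjacent (R s ∷ rim-tail s j)
  rim-walk s zero    = [-]
  rim-walk s (suc j) = R-L s ∷ L-R s ∷ rim-walk (suc s) j

  rim-end : ∀ s j → end (R s) (rim-tail s j) ≡ R (s + j)
  rim-end s zero    = R-cong (≡⇒≡ₘ (sym (+-identityʳ s)))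
  rim-end s (suc j) = trans (rim-end (suc s) j) (R-cong (≡⇒≡ₘ (sym (+-suc s j))))

  rim-all : ∀ (Q : Vertex → Set) s j →
    (∀ t → s ≤ t → t ≤ s + j → Q (R t)) → (∀ t → s ≤ t → t < s + j → Q (L t)) →
    All Q (R s ∷ rim-tail s j)
  rim-all Q s zero    QR QL = QR s ≤-refl (m≤m+n s 0) ∷ []
  rim-all Q s (suc j) QR QL =
    QR s ≤-refl (m≤m+n s (suc j)) ∷ QL s ≤-refl (m<m+n s (s≤s z≤n)) ∷
    rim-all Q (suc s) j (λ t s<t t≤ → QR t (<⇒≤ s<t) (subst (t ≤_) (sym (+-suc s j)) t≤))
                        (λ t s<t t< → QL t (<⇒≤ s<t) (subst (t <_) (sym (+-suc s j)) t<))

  back-tail : ℕ → ℕ → List Vertex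
  back-tail b zero    = []
  back-tail b (suc j) = L (b + j) ∷ R (b + j) ∷ back-tail b j

  back-walk : ∀ b j → Linked Adjacent (R (b + j) ∷ back-tail b j)
  back-walk b zero    = [-]
  back-walk b (suc j) =
    subst (λ z → Adjacent z (L (b + j))) (R-cong (≡⇒≡ₘ (sym (+-suc b j))))
          (adjacent-sym (L (b + j)) (R (suc (b + j))) (L-R (b + j))) ∷
    adjacent-sym (R (b + j)) (L (b + j)) (R-L (b + j)) ∷ back-walk b j

  back-end : ∀ b j → end (R (b + j)) (back-tail b j) ≡ R b
  back-end b zero    = R-cong (≡⇒≡ₘ (+-identityʳ b))
  back-end b (suc j) = back-end b j

  back-all : ∀ (Q : Vertex → Set) b j →
    (∀ t → b ≤ t → t ≤ b + j → Q (R t)) → (∀ t → b ≤ t → t < b + j → Q (L t)) →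
    All Q (R (b + j) ∷ back-tail b j)
  back-all Q b zero    QR QL = QR (b + 0) (m≤m+n b 0) ≤-refl ∷ []
  back-all Q b (suc j) QR QL =
    QR (b + suc j) (m≤m+n b (suc j)) ≤-refl ∷ QL (b + j) (m≤m+n b j) (+-monoʳ-< b ≤-refl) ∷
    back-all Q b j (λ t b≤t t≤ → QR t b≤t (≤-trans t≤ (+-monoʳ-≤ b (n≤1+n j))))
                   (λ t b≤t t< → QL t b≤t (<-≤-trans t< (+-monoʳ-≤ b (n≤1+n j))))

  walk-append : ∀ x xs y ys → Linked Adjacent (x ∷ xs) → Adjacent (end x xs) y →
                Linked Adjacent (y ∷ ys) → Linked Adjacent (x ∷ xs ++ y ∷ ys)
  walk-append x []        y ys [-]        xy w' = xy ∷ w'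
  walk-append x (x' ∷ xs) y ys (xx' ∷ w)  xy w' = xx' ∷ walk-append x' xs y ys w xy w'

  R-injective : ∀ {s t} → R s ≡ R t → s ≡ₘ t
  R-injective {s} {t} e = proj₁ (copy-indices s (suc s) t (suc t) e)

  L-injective : ∀ {s t} → L s ≡ L t → s ≡ₘ t
  L-injective {s} {t} e = proj₂ (copy-indices (suc s) s (suc t) t e)

  X-injective : ∀ {s t} → X s ≡ X t → s ≡ₘ t
  X-injective {s} {t} e = proj₁ (copy-indices s (s + h) t (t + h) e)

module NoTwoPageEmbedding (k : ℕ) where

  open import Data.Nat
  open import Data.Nat.Properties
  open import Data.Nat.DivMod using (n%n≡0)
  open import Data.Nat.Tactic.RingSolver using (solve-∀)
  open import Data.Bool using (Bool; true; false; _xor_; T)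
  open import Data.Bool.Properties using (T-irrelevant; xor-assoc; xor-comm; xor-identityʳ)
  open import Data.Bool.Solver using (module xor-∧-Solver)
  open import Data.Fin using (Fin) renaming (zero to 0F; suc to sucF)
  open import Data.Product using (_×_; _,_; proj₁; proj₂)
  open import Data.Empty using (⊥; ⊥-elim)
  open import Data.List using (List; []; _∷_; _++_)
  open import Data.List.Relation.Unary.All using (All; []; _∷_)
  import Data.List.Relation.Unary.All as All
  open import Data.List.Relation.Unary.All.Properties using (++⁺)
  open import Data.List.Relation.Unary.Linked using ([-]; _∷_)
  open import Relation.Nullary using (¬_; yes; no)
  open import Relation.Nullary.Decidable using (T?)
  open import Relation.Binary.PropositionalEquality
  open import Defs
  open Spine
  open Walks
  open Ladder k
  open Expansion (mobius h)
  open Rim k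

  open xor-∧-Solver using (solve; _:+_; _:=_)

  module Drawing (embedding : BookEmbedding (completeExpansion (mobius h)) 2) where

    position : Vertex → ℕ
    position = proj₁ embedding

    position-injective : ∀ {x y} → position x ≡ position y → x ≡ y
    position-injective = proj₁ (proj₂ embedding)

    page-of : (x y : Vertex) → Adjacent x y → Fin 2
    page-of = proj₁ (proj₂ (proj₂ embedding))

    page-of-sym : ∀ x y (p : Adjacent x y) (q : Adjacent y x) → page-of x y p ≡ page-of y x q
    page-of-sym = proj₁ (proj₂ (proj₂ (proj₂ embedding)))

    is-top : Fin 2 → Bool
    is-top 0F          = true
    is-top (sucF _)    = false

    is-top-injective : ∀ {i j} → is-top i ≡ is-top j → i ≡ j
    is-top-injective {0F}      {0F}      _ = refl
    is-top-injective {sucF 0F} {sucF 0F} _ = refl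

    page : Vertex → Vertex → Bool
    page x y with T? (adj (completeExpansion (mobius h)) x y)
    ... | yes p = is-top (page-of x y p)
    ... | no _  = false

    page-on-edge : ∀ x y (p : Adjacent x y) → page x y ≡ is-top (page-of x y p)
    page-on-edge x y p with T? (adj (completeExpansion (mobius h)) x y)
    ... | yes p' = cong (λ r → is-top (page-of x y r)) (T-irrelevant p' p)
    ... | no ¬p  = ⊥-elim (¬p p)

    page-off-edge : ∀ x y → ¬ Adjacent x y → page x y ≡ false
    page-off-edge x y ¬p with T? (adj (completeExpansion (mobius h)) x y)
    ... | yes p = ⊥-elim (¬p p)
    ... | no _  = refl

    page-sym : ∀ x y → page x y ≡ page y x
    page-sym x y with T? (adj (completeExpansion (mobius h)) x y)
    ... | yes p = trans (cong is-top (page-of-sym x y p (adjacent-sym x y p)))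
                        (sym (page-on-edge y x (adjacent-sym x y p)))
    ... | no ¬p = sym (page-off-edge y x (λ q → ¬p (adjacent-sym y x q)))

    no-crossing : ∀ a b c d → Adjacent a b → Adjacent c d → page a b ≡ page c d →
                  ¬ (position a < position c × position c < position b × position b < position d)
    no-crossing a b c d p q same = proj₂ (proj₂ (proj₂ (proj₂ embedding))) a b c d p q
      (is-top-injective (trans (sym (page-on-edge a b p)) (trans same (page-on-edge c d q))))

    open TwoPageDrawing Vertex position Adjacent (λ {a} {b} → adjacent-sym a b)
                       page page-sym no-crossing public

    avoids : ∀ {w} P → All (λ z → z ≢ w) P → Avoids (position w) P
    avoids []      []          = []
    avoids (z ∷ P) (z≢w ∷ rest) = (λ e → z≢w (position-injective e)) ∷ avoids P rest

    step-parity : ℕ → ℕ → Bool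
    step-parity s n = covers true (R s) (L s) n xor covers true (L s) (R (suc s)) n

    segment : ℕ → ℕ → ℕ → Bool
    segment s zero    n = false
    segment s (suc j) n = step-parity s n xor segment (suc s) j n

    forward-crossings : ∀ s j n → crossings true (R s ∷ rim-tail s j) n ≡ segment s j n
    forward-crossings s zero    n = refl
    forward-crossings s (suc j) n =
      trans (sym (xor-assoc (covers true (R s) (L s) n) _ _))
            (cong (step-parity s n xor_) (forward-crossings (suc s) j n))

    segment-cong : ∀ {s t} j n → s ≡ₘ t → segment s j n ≡ segment t j n
    segment-cong zero    n s≡t = refl
    segment-cong (suc j) n s≡t =
      cong₂ _xor_ (cong₂ _xor_ (cong₂ (λ x y → covers true x y n) (R-cong s≡t) (L-cong s≡t))
                               (cong₂ (λ x y → covers true x y n) (L-cong s≡t) (R-cong (+ₘ-congˡ 1 s≡t))))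
                  (segment-cong j n (+ₘ-congˡ 1 s≡t))

    segment-split : ∀ s i j n → segment s (i + j) n ≡ segment s i n xor segment (s + i) j n
    segment-split s zero    j n = segment-cong j n (≡⇒≡ₘ (sym (+-identityʳ s)))
    segment-split s (suc i) j n =
      trans (cong (step-parity s n xor_) (segment-split (suc s) i j n))
            (trans (sym (xor-assoc (step-parity s n) _ _))
                   (cong (segment s (suc i) n xor_) (segment-cong j n (≡⇒≡ₘ (sym (+-suc s i))))))

    backward-crossings : ∀ b j n → crossings true (R (b + j) ∷ back-tail b j) n ≡ segment b j n
    backward-crossings b zero    n = refl
    backward-crossings b (suc j) n = begin
      covers true (R (b + suc j)) (L (b + j)) n xor (covers true (L (b + j)) (R (b + j)) n xor rest)
        ≡⟨ cong₂ (λ x y → x xor (y xor rest))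
             (trans (covers-sym true (R (b + suc j)) (L (b + j)) n)
                    (cong (λ z → covers true (L (b + j)) z n) (R-cong (≡⇒≡ₘ (+-suc b j)))))
             (covers-sym true (L (b + j)) (R (b + j)) n) ⟩
      covers true (L (b + j)) (R (suc (b + j))) n xor (covers true (R (b + j)) (L (b + j)) n xor rest)
        ≡⟨ swap-front (covers true (L (b + j)) (R (suc (b + j))) n)
                      (covers true (R (b + j)) (L (b + j)) n) rest ⟩
      rest xor step-parity (b + j) n
        ≡⟨ cong (_xor step-parity (b + j) n) (backward-crossings b j n) ⟩
      segment b j n xor step-parity (b + j) n
        ≡⟨ cong (segment b j n xor_) (sym (xor-identityʳ _)) ⟩
      segment b j n xor segment (b + j) 1 n
        ≡⟨ sym (segment-split b j 1 n) ⟩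
      segment b (j + 1) n
        ≡⟨ cong (λ z → segment b z n) (+-comm j 1) ⟩
      segment b (suc j) n ∎
      where
      open ≡-Reasoning
      rest : Bool
      rest = crossings true (R (b + j) ∷ back-tail b j) n
      swap-front : ∀ x y r → x xor (y xor r) ≡ r xor (y xor x)
      swap-front = solve 3 (λ x y r → x :+ (y :+ r) := r :+ (y :+ x)) refl

    rim-start : ∀ {a} n → a ≤ m → segment a m n ≡ segment 0 m n
    rim-start {a} n a≤m = begin
      segment a m n                               ≡⟨ cong (λ z → segment a z n) (sym c+a≡m) ⟩
      segment a (c + a) n                         ≡⟨ segment-split a c a n ⟩
      segment a c n xor segment (a + c) a n       ≡⟨ cong (segment a c n xor_) (segment-cong a n around) ⟩
      segment a c n xor segment 0 a n             ≡⟨ xor-comm (segment a c n) _ ⟩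
      segment 0 a n xor segment (0 + a) c n       ≡⟨ sym (segment-split 0 a c n) ⟩
      segment 0 (a + c) n                         ≡⟨ cong (λ z → segment 0 z n) a+c≡m ⟩
      segment 0 m n                               ∎
      where
      open ≡-Reasoning
      c : ℕ
      c = m ∸ a
      a+c≡m : a + c ≡ m
      a+c≡m = m+[n∸m]≡n a≤m
      c+a≡m : c + a ≡ m
      c+a≡m = trans (+-comm c a) a+c≡m
      around : a + c ≡ₘ 0
      around = ≡ₘ-trans (≡⇒≡ₘ a+c≡m) (residues {m} {0} (n%n≡0 m))

    rim-side : Vertex → Bool
    rim-side x = segment 0 m (position x)

    h′ : ℕ
    h′ = 2 + k

    -- Two chords a ~ a + h and b ~ b + h with a < b < a + h interleave on the
    -- rim, so their copies X a and X b lie on opposite sides of it.  The rim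
    -- splits into two walks P₁ (forwards) and P₂ (backwards) from R a to
    -- R (a + h); together with P₃ through the chord of a they form a theta
    -- graph.  X b is reached from the first steps of P₁ and P₂ without meeting
    -- the other two walks, and the theta lemma gives the claim.
    module Interleaving (a d′ e : ℕ) (split : suc d′ + e ≡ h′) (a≤m : a ≤ m) where

      -- The second chord starts at b = a + d with d = suc d′ ≤ h′, and
      -- top = a + 2h - 1 is the last index on P₂.
      b top : ℕ
      b   = suc a + d′
      top = a + h + h′

      T₁ T₂ T₃ P₁ P₂ P₃ : List Vertex
      T₁ = L a ∷ R (suc a) ∷ rim-tail (suc a) h′
      T₂ = L top ∷ R top ∷ back-tail (a + h) h′
      T₃ = X a ∷ X (a + h) ∷ R (a + h) ∷ []
      P₁ = R a ∷ T₁
      P₂ = R a ∷ T₂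
      P₃ = R a ∷ T₃

      -- All indices used lie in the window [a, a + m).
      a<a+h : a < a + h
      a<a+h = m<m+n a (s≤s z≤n)

      a+h≤top : a + h ≤ top
      a+h≤top = m≤m+n (a + h) h′

      top<a+m : top < a + m
      top<a+m = subst (_< a + m) (sym (+-assoc a h h′)) (+-monoʳ-< a (+-monoʳ-< h (n<1+n h′)))

      a+h<a+m : a + h < a + m
      a+h<a+m = ≤-<-trans a+h≤top top<a+m

      b≤a+h′ : b ≤ a + h′
      b≤a+h′ = subst (_≤ a + h′) (+-suc a d′) (+-monoʳ-≤ a (subst (suc d′ ≤_) split (m≤m+n (suc d′) e)))

      b<a+h : b < a + h
      b<a+h = <-≤-trans (s≤s b≤a+h′) (≤-reflexive (sym (+-suc a h′)))

      around : a + h + h ≡ₘ a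
      around = ≡ₘ-trans (≡⇒≡ₘ (+-assoc a h h)) (+m-≡ₘ a)

      walk₁ : Walk P₁
      walk₁ = rim-walk a h

      walk₂ : Walk P₂
      walk₂ = subst (λ z → Walk (z ∷ T₂)) (R-cong around) (back-walk (a + h) h)

      walk₃ : Walk P₃
      walk₃ = R-X a ∷ X-X a ∷ adjacent-sym (R (a + h)) (X (a + h)) (R-X (a + h)) ∷ [-]

      end₁ : end (R (suc a)) (rim-tail (suc a) h′) ≡ R (a + h)
      end₁ = trans (rim-end (suc a) h′) (R-cong (≡⇒≡ₘ (sym (+-suc a h′))))

      end₂ : end (R top) (back-tail (a + h) h′) ≡ R (a + h)
      end₂ = back-end (a + h) h′

      T₁-misses-L : ∀ c → (∀ t → a ≤ t → t < a + h → ¬ t ≡ₘ c) → All (_≢ L c) T₁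
      T₁-misses-L c far = (λ e → far a ≤-refl a<a+h (L-injective e)) ∷
        rim-all _ (suc a) h′ (λ t _ _ → R≢L t c)
          (λ t lo hi e → far t (≤-trans (n≤1+n a) lo) (subst (t <_) (sym (+-suc a h′)) hi) (L-injective e))

      T₁-misses-R : ∀ c → (∀ t → a < t → t ≤ a + h → ¬ t ≡ₘ c) → All (_≢ R c) T₁
      T₁-misses-R c far = (λ e → R≢L c a (sym e)) ∷
        rim-all _ (suc a) h′ (λ t lo hi e → far t lo (subst (t ≤_) (sym (+-suc a h′)) hi) (R-injective e))
          (λ t _ _ e → R≢L c t (sym e))

      T₁-misses-X : ∀ c → All (_≢ X c) T₁
      T₁-misses-X c = (λ e → X≢L c a (sym e)) ∷
        rim-all _ (suc a) h′ (λ t _ _ e → X≢R c t (sym e)) (λ t _ _ e → X≢L c t (sym e))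

      T₂-misses-L : ∀ c → (∀ t → a + h ≤ t → t ≤ top → ¬ t ≡ₘ c) → All (_≢ L c) T₂
      T₂-misses-L c far = (λ e → far top a+h≤top ≤-refl (L-injective e)) ∷
        back-all _ (a + h) h′ (λ t _ _ → R≢L t c) (λ t lo hi e → far t lo (<⇒≤ hi) (L-injective e))

      T₂-misses-R : ∀ c → (∀ t → a + h ≤ t → t ≤ top → ¬ t ≡ₘ c) → All (_≢ R c) T₂
      T₂-misses-R c far = (λ e → R≢L c top (sym e)) ∷
        back-all _ (a + h) h′ (λ t lo hi e → far t lo hi (R-injective e)) (λ t _ _ e → R≢L c t (sym e))

      T₂-misses-X : ∀ c → All (_≢ X c) T₂
      T₂-misses-X c = (λ e → X≢L c top (sym e)) ∷
        back-all _ (a + h) h′ (λ t _ _ e → X≢R c t (sym e)) (λ t _ _ e → X≢L c t (sym e))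

      T₃-misses-L : ∀ c → All (_≢ L c) T₃
      T₃-misses-L c = X≢L a c ∷ X≢L (a + h) c ∷ R≢L (a + h) c ∷ []

      T₃-misses-R : ∀ c → ¬ a + h ≡ₘ c → All (_≢ R c) T₃
      T₃-misses-R c far = X≢R a c ∷ X≢R (a + h) c ∷ (λ e → far (R-injective e)) ∷ []

      T₃-misses-X : ∀ c → ¬ a ≡ₘ c → ¬ a + h ≡ₘ c → All (_≢ X c) T₃
      T₃-misses-X c far far′ = (λ e → far (X-injective e)) ∷ (λ e → far′ (X-injective e)) ∷
        (λ e → X≢R c (a + h) (sym e)) ∷ []

      theta : inside P₂ P₃ (position (L a)) xor
              (inside P₁ P₃ (position (L top)) xor inside P₁ P₂ (position (X a))) ≡ true
      theta = theta-parity (R a) (R (a + h)) (L a) (L top) (X a)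
        (R (suc a) ∷ rim-tail (suc a) h′) (R top ∷ back-tail (a + h) h′) (X (a + h) ∷ R (a + h) ∷ [])
        walk₁ walk₂ walk₃ end₁ end₂ refl
        (avoids T₁ (T₁-misses-R a (λ t a<t t≤ → separate′ ≤-refl a<t (≤-<-trans t≤ a+h<a+m))))
        (avoids T₁ (T₁-misses-L top (λ t a≤t t< → separate a≤t (<-≤-trans t< a+h≤top) top<a+m)))
        (avoids T₁ (T₁-misses-X a))
        (avoids T₂ (T₂-misses-R a far-from-a))
        (avoids T₂ (T₂-misses-L a far-from-a))
        (avoids T₂ (T₂-misses-X a))
        (avoids T₃ (T₃-misses-R a (separate′ ≤-refl a<a+h a+h<a+m)))
        (avoids T₃ (T₃-misses-L a))
        (avoids T₃ (T₃-misses-L top))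
        where
        far-from-a : ∀ t → a + h ≤ t → t ≤ top → ¬ t ≡ₘ a
        far-from-a t lo hi = separate′ ≤-refl (<-≤-trans a<a+h lo) (≤-<-trans hi top<a+m)

      Off : List Vertex → List Vertex → Vertex → Set
      Off P P′ w = All (_≢ w) P × All (_≢ w) P′

      off-avoids : ∀ {P P′} ws → All (Off P P′) ws →
                   All (λ w → Avoids (position w) P × Avoids (position w) P′) ws
      off-avoids {P} {P′} _ = All.map (λ (off , off′) → avoids P off , avoids P′ off′)

      a<b : a < b
      a<b = s≤s (m≤m+n a d′)

      Xb-off₃ : All (_≢ X b) P₃
      Xb-off₃ = (λ e → X≢R b a (sym e)) ∷
        T₃-misses-X b (separate ≤-refl a<b (<-trans b<a+h a+h<a+m)) (separate′ (<⇒≤ a<b) b<a+h a+h<a+m)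

      -- From the first step L a of P₁ to X b, along P₁ and avoiding P₂ and P₃.
      zs₁ : List Vertex
      zs₁ = (R (suc a) ∷ rim-tail (suc a) d′) ++ X b ∷ []

      walk-zs₁ : Walk (L a ∷ zs₁)
      walk-zs₁ = L-R a ∷ walk-append (R (suc a)) (rim-tail (suc a) d′) (X b) [] (rim-walk (suc a) d′)
        (subst (λ z → Adjacent z (X b)) (sym (rim-end (suc a) d′)) (R-X b)) [-]

      off-zs₁ : All (Off P₂ P₃) (L a ∷ zs₁)
      off-zs₁ = (R≢L a a ∷ T₂-misses-L a far , R≢L a a ∷ T₃-misses-L a) ∷
        ++⁺ (rim-all _ (suc a) d′ R-off L-off)
            (((λ e → X≢R b a (sym e)) ∷ T₂-misses-X b , Xb-off₃) ∷ [])
        where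
        far : ∀ t → a + h ≤ t → t ≤ top → ¬ t ≡ₘ a
        far t lo hi = separate′ ≤-refl (<-≤-trans a<a+h lo) (≤-<-trans hi top<a+m)
        R-off : ∀ t → suc a ≤ t → t ≤ b → Off P₂ P₃ (R t)
        R-off t a<t t≤b =
          (λ e → separate ≤-refl a<t t<a+m (R-injective e)) ∷
            T₂-misses-R t (λ t′ lo hi → separate′ (<⇒≤ a<t) (<-≤-trans t<a+h lo) (≤-<-trans hi top<a+m)) ,
          (λ e → separate ≤-refl a<t t<a+m (R-injective e)) ∷
            T₃-misses-R t (separate′ (<⇒≤ a<t) t<a+h a+h<a+m)
          where
          t<a+h : t < a + h
          t<a+h = ≤-<-trans t≤b b<a+h
          t<a+m : t < a + m
          t<a+m = <-trans t<a+h a+h<a+m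
        L-off : ∀ t → suc a ≤ t → t < b → Off P₂ P₃ (L t)
        L-off t a<t t<b =
          R≢L a t ∷ T₂-misses-L t (λ t′ lo hi → separate′ (<⇒≤ a<t) (<-≤-trans (<-trans t<b b<a+h) lo)
                                                        (≤-<-trans hi top<a+m)) ,
          R≢L a t ∷ T₃-misses-L t

      -- From the first step L top of P₂ to X b: along P₂ down to R c₀, then
      -- through the chord of c₀ = b + h, avoiding P₁ and P₃.
      c₀ : ℕ
      c₀ = a + h + suc d′

      reach : c₀ + e ≡ top
      reach = trans (+-assoc (a + h) (suc d′) e) (cong ((a + h) +_) split)

      a+h<c₀ : a + h < c₀
      a+h<c₀ = m<m+n (a + h) (s≤s z≤n)

      c₀<a+m : c₀ < a + m
      c₀<a+m = ≤-<-trans (subst (c₀ ≤_) reach (m≤m+n c₀ e)) top<a+m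

      zs₂ : List Vertex
      zs₂ = (R (c₀ + e) ∷ back-tail c₀ e) ++ X c₀ ∷ X b ∷ []

      walk-zs₂ : Walk (L top ∷ zs₂)
      walk-zs₂ =
        subst (Adjacent (L top)) (R-cong (≡⇒≡ₘ (sym reach))) (adjacent-sym (R top) (L top) (R-L top)) ∷
        walk-append (R (c₀ + e)) (back-tail c₀ e) (X c₀) (X b ∷ []) (back-walk c₀ e)
          (subst (λ z → Adjacent z (X c₀)) (sym (back-end c₀ e)) (R-X c₀))
          (subst (Adjacent (X c₀)) (X-cong (≡ₘ-trans (≡⇒≡ₘ (regroup a d′ h)) (+m-≡ₘ b))) (X-X c₀) ∷ [-])
        where
        regroup : ∀ a d h → a + h + suc d + h ≡ suc a + d + (h + h)
        regroup = solve-∀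

      off-zs₂ : All (Off P₁ P₃) (L top ∷ zs₂)
      off-zs₂ =
        (R≢L a top ∷ T₁-misses-L top (λ t a≤t t< → separate a≤t (<-≤-trans t< a+h≤top) top<a+m) ,
         R≢L a top ∷ T₃-misses-L top) ∷
        ++⁺ (back-all _ c₀ e R-off L-off)
            (((λ e → X≢R c₀ a (sym e)) ∷ T₁-misses-X c₀ ,
              (λ e → X≢R c₀ a (sym e)) ∷ T₃-misses-X c₀ (separate ≤-refl a<c₀ c₀<a+m)
                                                        (separate (<⇒≤ a<a+h) a+h<c₀ c₀<a+m)) ∷
             ((λ e → X≢R b a (sym e)) ∷ T₁-misses-X b , Xb-off₃) ∷ [])
        where
        a<c₀ : a < c₀
        a<c₀ = <-trans a<a+h a+h<c₀
        R-off : ∀ t → c₀ ≤ t → t ≤ c₀ + e → Off P₁ P₃ (R t)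
        R-off t c₀≤t t≤ =
          (λ e → separate ≤-refl a<t t<a+m (R-injective e)) ∷
            T₁-misses-R t (λ t′ lo hi → separate (<⇒≤ lo) (≤-<-trans hi a+h<t) t<a+m) ,
          (λ e → separate ≤-refl a<t t<a+m (R-injective e)) ∷
            T₃-misses-R t (separate (<⇒≤ a<a+h) a+h<t t<a+m)
          where
          a+h<t : a + h < t
          a+h<t = <-≤-trans a+h<c₀ c₀≤t
          a<t : a < t
          a<t = <-trans a<a+h a+h<t
          t<a+m : t < a + m
          t<a+m = ≤-<-trans (subst (t ≤_) reach t≤) top<a+m
        L-off : ∀ t → c₀ ≤ t → t < c₀ + e → Off P₁ P₃ (L t)
        L-off t c₀≤t t< =
          R≢L a t ∷ T₁-misses-L t (λ t′ lo hi → separate lo (<-trans hi (<-≤-trans a+h<c₀ c₀≤t))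
                                                           (<-≤-trans (subst (t <_) reach t<) (<⇒≤ top<a+m))) ,
          R≢L a t ∷ T₃-misses-L t

      side₁ : inside P₂ P₃ (position (L a)) ≡ inside P₂ P₃ (position (X b))
      side₁ = trans (inside-along-walk (R a) T₂ T₃ end₂ walk₂ walk₃ (L a) zs₁ walk-zs₁
                                       (off-avoids _ off-zs₁))
                    (cong (λ z → inside P₂ P₃ (position z)) (end-++ (R (suc a)) (rim-tail (suc a) d′) (X b) []))

      side₂ : inside P₁ P₃ (position (L top)) ≡ inside P₁ P₃ (position (X b))
      side₂ = trans (inside-along-walk (R a) T₁ T₃ end₁ walk₁ walk₃ (L top) zs₂ walk-zs₂
                                       (off-avoids _ off-zs₂))
                    (cong (λ z → inside P₁ P₃ (position z))
                          (end-++ (R (c₀ + e)) (back-tail c₀ e) (X c₀) (X b ∷ [])))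

      rim-curve : ∀ x → inside P₁ P₂ (position x) ≡ rim-side x
      rim-curve x = begin
        crossings true P₁ n xor crossings true P₂ n
          ≡⟨ cong₂ _xor_ (forward-crossings a h n)
               (trans (cong (λ z → crossings true (z ∷ T₂) n) (R-cong (≡ₘ-sym around)))
                      (backward-crossings (a + h) h n)) ⟩
        segment a h n xor segment (a + h) h n
          ≡⟨ sym (segment-split a h h n) ⟩
        segment a m n
          ≡⟨ rim-start n a≤m ⟩
        segment 0 m n ∎
        where
        open ≡-Reasoning
        n : ℕ
        n = position x

      chords-separate : rim-side (X a) xor rim-side (X b) ≡ true
      chords-separate = begin
        rim-side (X a) xor rim-side (X b)
          ≡⟨ cong₂ _xor_ (sym (rim-curve (X a))) (sym (rim-curve (X b))) ⟩
        ρ (X a) xor (c₁ xor c₂)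
          ≡⟨ regroup (ρ (X a)) c₁ c₂ c₃ ⟩
        inside P₂ P₃ (position (X b)) xor (inside P₁ P₃ (position (X b)) xor ρ (X a))
          ≡⟨ cong₂ (λ p q → p xor (q xor ρ (X a))) (sym side₁) (sym side₂) ⟩
        inside P₂ P₃ (position (L a)) xor (inside P₁ P₃ (position (L top)) xor ρ (X a))
          ≡⟨ theta ⟩
        true ∎
        where
        open ≡-Reasoning
        ρ : Vertex → Bool
        ρ x = inside P₁ P₂ (position x)
        c₁ c₂ c₃ : Bool
        c₁ = crossings true P₁ (position (X b))
        c₂ = crossings true P₂ (position (X b))
        c₃ = crossings true P₃ (position (X b))
        regroup : ∀ r c₁ c₂ c₃ → r xor (c₁ xor c₂) ≡ (c₂ xor c₃) xor ((c₁ xor c₃) xor r)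
        regroup = solve 4 (λ r c₁ c₂ c₃ → r :+ (c₁ :+ c₂) := (c₂ :+ c₃) :+ ((c₁ :+ c₃) :+ r)) refl

    -- Three pairwise interleaving chords 0, 1, 2 cannot lie pairwise on
    -- opposite sides of the rim.
    contradiction : ⊥
    contradiction = odd-cycle (rim-side (X 0)) (rim-side (X 1)) (rim-side (X 2))
      (Interleaving.chords-separate 0 0 (suc k) refl z≤n)
      (Interleaving.chords-separate 0 1 k refl z≤n)
      (Interleaving.chords-separate 1 0 (suc k) refl (s≤s z≤n))
      where
      odd-cycle : ∀ x y z → x xor y ≡ true → x xor z ≡ true → y xor z ≡ true → ⊥
      odd-cycle true  true  _     ()
      odd-cycle false false _     ()
      odd-cycle true  false true  _  ()
      odd-cycle true  false false _  _  ()
      odd-cycle false true  true  _  _  ()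
      odd-cycle false true  false _  ()

  no-two-page-embedding : ¬ BookEmbedding (completeExpansion (mobius h)) 2
  no-two-page-embedding embedding = Drawing.contradiction embedding

add-page : ∀ {G j} → BookEmbedding G j → BookEmbedding G (suc j)
add-page (position , injective , page , page-sym , no-crossing) =
  position , injective , (λ u v p → inject₁ (page u v p)) , (λ u v p q → cong inject₁ (page-sym u v p q)) ,
  (λ a b c d p q same → no-crossing a b c d p q (inject₁-injective same))

theorem3p5 : (h : ℕ) → 3 ≤ h → PagenumberIs (completeExpansion (mobius h)) 3
theorem3p5 (suc (suc (suc k))) (s≤s (s≤s (s≤s z≤n))) =
  ThreePageEmbedding.three-page-embedding k , fewer
  where
  G : Graph
  G = completeExpansion (mobius (suc (suc (suc k))))
  two-impossible : ¬ BookEmbedding G 2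
  two-impossible = NoTwoPageEmbedding.no-two-page-embedding k
  fewer : ∀ j → j < 3 → ¬ BookEmbedding G j
  fewer 0 _ = λ embedding → two-impossible (add-page {G} (add-page {G} embedding))
  fewer 1 _ = λ embedding → two-impossible (add-page {G} embedding)
  fewer 2 _ = two-impossible
  fewer (suc (suc (suc _))) (s≤s (s≤s (s≤s ())))
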